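{- Let $D_m=\langle a,b\mid a^m=b^2=1,\ ab=ba^{ -1}\rangle$ for $m\ge3$. (i) $\Gamma_N(D_4)\cong 2K_2$, and if $n=2^\alpha$ with $\alpha\ge3$ then $\Gamma_N(D_n)\cong 2\big(\Gamma_N(D_{n/2})+K_2\big)$. (ii) Let $p$ be an odd prime. Then $\Gamma_N(D_p)\cong\overline{K}_p$, and if $n=p^\alpha$ with $\alpha\ge2$ then $\Gamma_N(D_n)\cong p\big(\Gamma_N(D_{n/p})+K_1\big)$. (iii) If $n=2p$ with $p$ an odd prime, then $\Gamma_N(D_n)\cong pK_3$. (iv) If $n=pq$ with $p,q$ primes and $2<p<q$, then $\Gamma_N(D_n)$ is isomorphic to the graph with pairwise distinct vertices $u_1,\dots,u_p$, $v_1,\dots,v_q$, $w_{ij}$ ($1\le i\le p$, $1\le j\le q$), whose edge set is the union over all $i,j$ of the edges of the triangle (complete graph) on $\{u_i,v_j,w_{ij}\}$.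
   Context: $\Gamma_N(G)$ denotes the simple graph whose vertices are the proper non-normal subgroups of the group $G$, two distinct vertices $H,K$ being adjacent iff $HK=KH$. $K_m$ is the complete graph, $\overline{K}_m$ the edgeless graph on $m$ vertices, $mG$ the disjoint union of $m$ copies of $G$, and $G_1+G_2$ the join (disjoint union plus all edges between $G_1$ and $G_2$). -}

module Defs where

open import Data.Nat using (ℕ; zero; suc; _+_; _∸_; _%_; NonZero)
open import Data.Nat.DivMod using (m%n<n)
open import Data.Fin using (Fin; toℕ; fromℕ<; splitAt; join)
open import Data.Fin.Subset using (Subset; _∈_; ⊤)
open import Data.Bool using (Bool; true; false; _xor_)
open import Data.Product using (Σ; _×_; _,_; ∃₂)
open import Data.Sum using (_⊎_; inj₁; inj₂)
open import Data.Empty renaming (⊥ to Empty)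
open import Data.Unit renaming (⊤ to Unit)
open import Relation.Nullary using (¬_)
open import Relation.Binary.PropositionalEquality using (_≡_; _≢_)
open import Function.Bundles using (_⤖_; _⇔_; module Bijection)

-- Finite groups, given by their multiplication table on Fin N.
-- (Only the operations are needed to define Γ_N; the group laws hold for
--  the dihedral groups below but are not recorded as fields.)

record FinGroup : Set where
  field
    N    : ℕ
    _·_  : Fin N → Fin N → Fin N
    e    : Fin N
    _⁻¹  : Fin N → Fin N

module _ (G : FinGroup) where
  open FinGroup G

  record IsSubgroup (H : Subset N) : Set where
    field
      has-e   : e ∈ H
      closed· : ∀ x y → x ∈ H → y ∈ H → (x · y) ∈ H
      closed⁻ : ∀ x → x ∈ H → (x ⁻¹) ∈ H

  IsNormal : Subset N → Set
  IsNormal H = ∀ g h → h ∈ H → ((g · h) · (g ⁻¹)) ∈ H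

  IsVertex : Subset N → Set
  IsVertex H = IsSubgroup H × H ≢ ⊤ × ¬ IsNormal H

  InProd : Subset N → Subset N → Fin N → Set
  InProd H K x = ∃₂ λ h k → h ∈ H × k ∈ K × x ≡ h · k

  Permute : Subset N → Subset N → Set
  Permute H K = ∀ x → (InProd H K x → InProd K H x) × (InProd K H x → InProd H K x)

record Graph : Set₁ where
  field
    V   : Set
    Adj : V → V → Set

open Graph public

record _≅_ (G₁ G₂ : Graph) : Set where
  field
    f    : V G₁ ⤖ V G₂
    adj  : ∀ u v → Adj G₁ u v ⇔ Adj G₂ (Bijection.to f u) (Bijection.to f v)

infix 4 _≅_

-- A vertex of Γ_N(G): a subset of G together with an (irrelevant) proof that it is
-- a proper non-normal subgroup. Irrelevance makes vertices equal iff their subsets are.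
record ΓVertex (G : FinGroup) : Set where
  constructor vtx
  field
    sub   : Subset (FinGroup.N G)
    .isV  : IsVertex G sub

open ΓVertex public

Γ_N : FinGroup → Graph
Γ_N G = record
  { V   = ΓVertex G
  ; Adj = λ H K → sub H ≢ sub K × Permute G (sub H) (sub K) }

K : ℕ → Graph
K m = record { V = Fin m ; Adj = λ u v → u ≢ v }

Kbar : ℕ → Graph
Kbar m = record { V = Fin m ; Adj = λ _ _ → Empty }

copies : ℕ → Graph → Graph
copies m G = record
  { V   = Fin m × V G
  ; Adj = λ { (i , u) (j , v) → i ≡ j × Adj G u v } }

_⊕_ : Graph → Graph → Graph
G₁ ⊕ G₂ = record { V = V G₁ ⊎ V G₂ ; Adj = adj }
  where
  adj : V G₁ ⊎ V G₂ → V G₁ ⊎ V G₂ → Set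
  adj (inj₁ u) (inj₁ v) = Adj G₁ u v
  adj (inj₂ u) (inj₂ v) = Adj G₂ u v
  adj (inj₁ _) (inj₂ _) = Unit
  adj (inj₂ _) (inj₁ _) = Unit

infixl 6 _⊕_

-- The graph of (iv): vertices u_i (inj₁ i), v_j (inj₂ (inj₁ j)), w_ij (inj₂ (inj₂ (i , j)));
-- edges = union over i, j of the edges of the triangle on {u_i, v_j, w_ij}.
TriVertex : ℕ → ℕ → Set
TriVertex p q = Fin p ⊎ (Fin q ⊎ (Fin p × Fin q))

InTriangle : ∀ {p q} → Fin p → Fin q → TriVertex p q → Set
InTriangle i j x = (x ≡ inj₁ i) ⊎ ((x ≡ inj₂ (inj₁ j)) ⊎ (x ≡ inj₂ (inj₂ (i , j))))

TriGraph : ℕ → ℕ → Graph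
TriGraph p q = record
  { V   = TriVertex p q
  ; Adj = λ x y → x ≢ y × ∃₂ λ (i : Fin p) (j : Fin q) → InTriangle i j x × InTriangle i j y }

-- Element a^i b^s is (i , s) with i : Fin m (exponent mod m), s : Bool (false = b^0).
-- Encoded in Fin (m + m): a^i ↦ i ↑ˡ m, a^i b ↦ m ↑ʳ i.

module _ (m : ℕ) .{{_ : NonZero m}} where

  modm : ℕ → Fin m
  modm x = fromℕ< (m%n<n x m)

  -- (a^i b^s)(a^j b^t) = a^(i + (-1)^s j) b^(s xor t)
  dmul : Fin m × Bool → Fin m × Bool → Fin m × Bool
  dmul (i , false) (j , t) = modm (toℕ i + toℕ j) , t
  dmul (i , true)  (j , t) = modm (toℕ i + (m ∸ toℕ j)) , (true xor t)

  dinv : Fin m × Bool → Fin m × Bool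
  dinv (i , false) = modm (m ∸ toℕ i) , false
  dinv (i , true)  = i , true

  dec : Fin (m + m) → Fin m × Bool
  dec x with splitAt m x
  ... | inj₁ i = i , false
  ... | inj₂ i = i , true

  enc : Fin m × Bool → Fin (m + m)
  enc (i , false) = join m m (inj₁ i)
  enc (i , true)  = join m m (inj₂ i)

  Dih : FinGroup
  Dih = record
    { N   = m + m
    ; _·_ = λ x y → enc (dmul (dec x) (dec y))
    ; e   = enc (modm 0 , false)
    ; _⁻¹ = λ x → enc (dinv (dec x)) }

module Submission where

-- Writing the elements of D_m as a^x b^s, every proper non-normal subgroup is
-- Sub d i = ⟨a^d, a^i b⟩ for a unique pair with d ∣ m, d ≥ 3, i < d (sections
-- Subgroups and Classification), and Sub d i, Sub e j permute iff
-- 2i ≡ 2j modulo the subgroup of ℤ generated by d, e and m ("compatible"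
-- parameters, section Permutability).  So Γ_N(D_m) is isomorphic to a purely
-- arithmetic graph on parameters (ParameterGraph).  The theorem is then
-- combinatorics of parameter graphs: parameters with d ∣ 2 form a clique
-- joined to everything (SplitSmallDivisor); if every admissible d is a
-- multiple of p, writing (d, i) = (d′p, c + i′p) splits the graph into p
-- copies indexed by the residue c (SplitCopies, with the arithmetic in
-- Lifting); and for m = pq the Chinese remainder theorem identifies it with
-- the union of triangles (TwoPrimes).

module Congruence where

  open import Data.Nat as ℕ using (ℕ; suc; NonZero; _%_; _/_; _<_)
  open import Data.Nat.DivMod using (m≡m%n+[m/n]*n; [m+kn]%n≡m%n; m<n⇒m%n≡m)
  open import Data.Nat.Divisibility using (_∣_; divides)
  open import Data.Integer using (ℤ; +_; -[1+_]; _+_; _*_; -_; _-_)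
  open import Data.Integer.Properties using (pos-+; pos-*; +-injective)
  open import Data.Integer.DivMod using (a≡a%ℕn+[a/ℕn]*n; _%ℕ_; _/ℕ_)
  open import Data.Integer.Tactic.RingSolver using (solve-∀)
  open import Relation.Binary.PropositionalEquality

  record _≡_[mod_] (a b : ℤ) (n : ℕ) : Set where
    constructor witness
    field
      quot : ℤ
      eq   : a ≡ b + quot * + n

  infix 4 _≡_[mod_]

  module _ {n : ℕ} where

    mod-reflexive : ∀ {a b} → a ≡ b → a ≡ b [mod n ]
    mod-reflexive {a} refl = witness (+ 0) (identity a (+ n))
      where identity : ∀ a n → a ≡ a + + 0 * n
            identity = solve-∀

    mod-refl : ∀ {a} → a ≡ a [mod n ]
    mod-refl = mod-reflexive refl

    mod-sym : ∀ {a b} → a ≡ b [mod n ] → b ≡ a [mod n ]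
    mod-sym {b = b} (witness q refl) = witness (- q) (identity b q (+ n))
      where identity : ∀ b q n → b ≡ (b + q * n) + - q * n
            identity = solve-∀

    mod-trans : ∀ {a b c} → a ≡ b [mod n ] → b ≡ c [mod n ] → a ≡ c [mod n ]
    mod-trans {c = c} (witness q refl) (witness r refl) = witness (r + q) (identity c q r (+ n))
      where identity : ∀ c q r n → (c + r * n) + q * n ≡ c + (r + q) * n
            identity = solve-∀

    mod-+ : ∀ {a b c d} → a ≡ b [mod n ] → c ≡ d [mod n ] → a + c ≡ b + d [mod n ]
    mod-+ {b = b} {d = d} (witness q refl) (witness r refl) = witness (q + r) (identity b d q r (+ n))
      where identity : ∀ b d q r n → (b + q * n) + (d + r * n) ≡ (b + d) + (q + r) * n
            identity = solve-∀

    mod-*ˡ : ∀ {a b} c → a ≡ b [mod n ] → c * a ≡ c * b [mod n ]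
    mod-*ˡ {b = b} c (witness q refl) = witness (c * q) (identity b c q (+ n))
      where identity : ∀ b c q n → c * (b + q * n) ≡ c * b + (c * q) * n
            identity = solve-∀

    mod-neg : ∀ {a b} → a ≡ b [mod n ] → - a ≡ - b [mod n ]
    mod-neg {b = b} (witness q refl) = witness (- q) (identity b q (+ n))
      where identity : ∀ b q n → - (b + q * n) ≡ - b + - q * n
            identity = solve-∀

    mod-multiple : ∀ k → k * + n ≡ + 0 [mod n ]
    mod-multiple k = witness k (identity k (+ n))
      where identity : ∀ k n → k * n ≡ + 0 + k * n
            identity = solve-∀

    mod-self : + n ≡ + 0 [mod n ]
    mod-self = mod-trans (mod-reflexive (identity (+ n))) (mod-multiple (+ 1))
      where identity : ∀ n → n ≡ + 1 * n
            identity = solve-∀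

  mod-divisor : ∀ {n d a b} → d ∣ n → a ≡ b [mod n ] → a ≡ b [mod d ]
  mod-divisor {d = d} {b = b} (divides c refl) (witness q refl) =
    witness (q * + c) (trans (cong (λ z → b + q * z) (pos-* c d)) (identity b q (+ c) (+ d)))
    where identity : ∀ b q c d → b + q * (c * d) ≡ b + (q * c) * d
          identity = solve-∀

  mod-modulus : ∀ {n n′ a b} → n ≡ n′ → a ≡ b [mod n ] → a ≡ b [mod n′ ]
  mod-modulus refl c = c

  %⇒mod : ∀ {n x y} .{{_ : NonZero n}} → x % n ≡ y % n → + x ≡ + y [mod n ]
  %⇒mod {n} {x} {y} eq = witness (+ (x / n) - + (y / n)) (begin
      + x                                    ≡⟨ cong +_ (m≡m%n+[m/n]*n x n) ⟩
      + (x % n ℕ.+ x / n ℕ.* n)              ≡⟨ split x ⟩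
      + (x % n) + + (x / n) * + n            ≡⟨ cong (λ z → + z + + (x / n) * + n) eq ⟩
      + (y % n) + + (x / n) * + n            ≡⟨ shift (+ (y % n)) (+ (x / n)) (+ (y / n)) (+ n) ⟩
      (+ (y % n) + + (y / n) * + n) + (+ (x / n) - + (y / n)) * + n
        ≡⟨ cong (_+ (+ (x / n) - + (y / n)) * + n) (sym (split y)) ⟩
      + (y % n ℕ.+ y / n ℕ.* n) + (+ (x / n) - + (y / n)) * + n
        ≡⟨ cong (λ z → + z + (+ (x / n) - + (y / n)) * + n) (sym (m≡m%n+[m/n]*n y n)) ⟩
      + y + (+ (x / n) - + (y / n)) * + n    ∎)
    where
    open ≡-Reasoning
    split : ∀ z → + (z % n ℕ.+ z / n ℕ.* n) ≡ + (z % n) + + (z / n) * + n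
    split z = trans (pos-+ (z % n) _) (cong (_+_ (+ (z % n))) (pos-* (z / n) n))
    shift : ∀ a x y n → a + x * n ≡ (a + y * n) + (x - y) * n
    shift = solve-∀

  mod⇒% : ∀ {n x y} .{{_ : NonZero n}} → + x ≡ + y [mod n ] → x % n ≡ y % n
  mod⇒% {n} {x} {y} (witness (+ k) eq) =
    trans (cong (_% n) x≡y+kn) ([m+kn]%n≡m%n y k n)
    where
    x≡y+kn : x ≡ y ℕ.+ k ℕ.* n
    x≡y+kn = +-injective (trans eq (trans (cong (_+_ (+ y)) (sym (pos-* k n))) (sym (pos-+ y _))))
  mod⇒% {n} {x} {y} (witness -[1+ k ] eq) =
    sym (trans (cong (_% n) y≡x+kn) ([m+kn]%n≡m%n x (suc k) n))
    where
    identity : ∀ y q n → y ≡ (y + (- q) * n) + q * n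
    identity = solve-∀
    y≡x+kn : y ≡ x ℕ.+ suc k ℕ.* n
    y≡x+kn = +-injective (trans (trans (identity (+ y) (+ suc k) (+ n)) (cong (_+ + suc k * + n) (sym eq)))
               (trans (cong (_+_ (+ x)) (sym (pos-* (suc k) n))) (sym (pos-+ x _))))

  mod-residue : ∀ {n a b} .{{_ : NonZero n}} → a < n → b < n → + a ≡ + b [mod n ] → a ≡ b
  mod-residue a<n b<n c = trans (sym (m<n⇒m%n≡m a<n)) (trans (mod⇒% c) (m<n⇒m%n≡m b<n))

  residue : (n : ℕ) .{{_ : NonZero n}} → ℤ → ℕ
  residue n z = z %ℕ n

  residue-mod : ∀ n .{{_ : NonZero n}} z → + residue n z ≡ z [mod n ]
  residue-mod n z = mod-sym (witness (z /ℕ n) (a≡a%ℕn+[a/ℕn]*n z n))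

module Dihedral where

  open import Defs
  open Congruence
  open import Data.Nat as ℕ using (ℕ; NonZero; _%_; _∸_)
  open import Data.Nat.Properties using (+-comm; m+[n∸m]≡n)
  open import Data.Nat.DivMod using (%-distribˡ-+; m%n%n≡m%n; m<n⇒m%n≡m; n%n≡0; m%n≤n)
  open import Data.Fin using (Fin; toℕ; splitAt; join)
  open import Data.Fin.Properties using (toℕ-fromℕ<; fromℕ<-cong; splitAt-join; join-splitAt; toℕ<n; fromℕ<-toℕ)
  open import Data.Integer using (ℤ; +_; _+_; -_)
  open import Data.Integer.Properties using (pos-+)
  open import Data.Integer.Tactic.RingSolver using (solve-∀)
  open import Data.Bool using (Bool; true; false; _xor_; not)
  open import Data.Product using (_×_; _,_; proj₁; proj₂)
  open import Data.Sum using (inj₁; inj₂)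
  open import Relation.Binary.PropositionalEquality

  -- b^s a^y = a^(±y) b^s: the sign an exponent acquires when moved across b^s.
  signed : Bool → ℤ → ℤ
  signed false a = a
  signed true  a = - a

  signed-mod : ∀ {n a b} s → a ≡ b [mod n ] → signed s a ≡ signed s b [mod n ]
  signed-mod false c = c
  signed-mod true  c = mod-neg c

  module _ (m : ℕ) .{{_ : NonZero m}} where
    open FinGroup (Dih m)

    E : ℕ → Bool → Fin (m ℕ.+ m)
    E x s = enc m (modm m x , s)

    dec-enc : ∀ z → dec m (enc m z) ≡ z
    dec-enc (i , false) rewrite splitAt-join m m (inj₁ i) = refl
    dec-enc (i , true)  rewrite splitAt-join m m (inj₂ i) = refl

    toℕ-modm : ∀ x → toℕ (modm m x) ≡ x % m
    toℕ-modm x = toℕ-fromℕ< _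

    private
      enc-dec : ∀ g → enc m (dec m g) ≡ g
      enc-dec g with splitAt m g in eq
      ... | inj₁ _ = trans (cong (join m m) (sym eq)) (join-splitAt m m g)
      ... | inj₂ _ = trans (cong (join m m) (sym eq)) (join-splitAt m m g)

      modm-toℕ : ∀ (r : Fin m) → modm m (toℕ r) ≡ r
      modm-toℕ r = trans (fromℕ<-cong _ _ (m<n⇒m%n≡m (toℕ<n r)) _ (toℕ<n r)) (fromℕ<-toℕ r (toℕ<n r))

      %-+ˡ : ∀ x y → (x % m ℕ.+ y) % m ≡ (x ℕ.+ y) % m
      %-+ˡ x y = begin
        (x % m ℕ.+ y) % m           ≡⟨ %-distribˡ-+ (x % m) y m ⟩
        (x % m % m ℕ.+ y % m) % m   ≡⟨ cong (λ z → (z ℕ.+ y % m) % m) (m%n%n≡m%n x m) ⟩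
        (x % m ℕ.+ y % m) % m       ≡⟨ %-distribˡ-+ x y m ⟨
        (x ℕ.+ y) % m               ∎
        where open ≡-Reasoning

      %-+ʳ : ∀ x y → (x ℕ.+ y % m) % m ≡ (x ℕ.+ y) % m
      %-+ʳ x y = trans (cong (_% m) (+-comm x (y % m))) (trans (%-+ˡ y x) (cong (_% m) (+-comm y x)))

    elimE : (P : Fin (m ℕ.+ m) → Set) → (∀ x s → P (E x s)) → ∀ g → P g
    elimE P f g = subst P (sym normal-form) (f (toℕ (proj₁ (dec m g))) (proj₂ (dec m g)))
      where
      normal-form : g ≡ E (toℕ (proj₁ (dec m g))) (proj₂ (dec m g))
      normal-form = trans (sym (enc-dec g)) (cong (λ r → enc m (r , proj₂ (dec m g))) (sym (modm-toℕ _)))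

    E-mod : ∀ {x y} s → + x ≡ + y [mod m ] → E x s ≡ E y s
    E-mod s c = cong (λ r → enc m (r , s)) (fromℕ<-cong _ _ (mod⇒% c) _ _)

    E-injective : ∀ {x y s t} → E x s ≡ E y t → + x ≡ + y [mod m ] × s ≡ t
    E-injective {x} {y} eq =
      %⇒mod (trans (sym (toℕ-modm x)) (trans (cong (λ z → toℕ (proj₁ z)) same) (toℕ-modm y))) ,
      cong proj₂ same
      where same = trans (sym (dec-enc _)) (trans (cong (dec m) eq) (dec-enc _))

    negExp : ℕ → ℕ
    negExp y = m ∸ y % m

    prodExp : Bool → ℕ → ℕ → ℕ
    prodExp false x y = x ℕ.+ y
    prodExp true  x y = x ℕ.+ negExp y

    invExp : Bool → ℕ → ℕ
    invExp false x = negExp x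
    invExp true  x = x

    mul-E : ∀ x s y t → E x s · E y t ≡ E (prodExp s x y) (s xor t)
    mul-E x false y t rewrite dec-enc (modm m x , false) | dec-enc (modm m y , t) | toℕ-modm x | toℕ-modm y =
      cong (λ r → enc m (r , t)) (fromℕ<-cong _ _ (trans (%-+ˡ x (y % m)) (%-+ʳ x y)) _ _)
    mul-E x true y t rewrite dec-enc (modm m x , true) | dec-enc (modm m y , t) | toℕ-modm x | toℕ-modm y =
      cong (λ r → enc m (r , true xor t)) (fromℕ<-cong _ _ (%-+ˡ x (m ∸ y % m)) _ _)

    inv-E : ∀ x s → E x s ⁻¹ ≡ E (invExp s x) s
    inv-E x false rewrite dec-enc (modm m x , false) | toℕ-modm x = refl
    inv-E x true  rewrite dec-enc (modm m x , true) = refl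

    negExp-mod : ∀ x → + negExp x ≡ - + x [mod m ]
    negExp-mod x = mod-trans (mod-reflexive (sym (cancel (+ negExp x) (+ x))))
      (mod-trans (mod-+ (mod-trans (mod-reflexive (sym (pos-+ (negExp x) x))) sum≡0) (mod-refl {a = - + x}))
        (mod-reflexive (zero-left (- + x))))
      where
      cancel : ∀ a b → a + b + - b ≡ a
      cancel = solve-∀
      zero-left : ∀ a → + 0 + a ≡ a
      zero-left = solve-∀
      sum≡0 : + (negExp x ℕ.+ x) ≡ + 0 [mod m ]
      sum≡0 = %⇒mod (begin
        (negExp x ℕ.+ x) % m      ≡⟨ cong (_% m) (+-comm (negExp x) x) ⟩
        (x ℕ.+ negExp x) % m      ≡⟨ %-+ˡ x (negExp x) ⟨
        (x % m ℕ.+ negExp x) % m  ≡⟨ cong (_% m) (m+[n∸m]≡n (m%n≤n x m)) ⟩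
        m % m                     ≡⟨ n%n≡0 m ⟩
        0                         ≡⟨ m<n⇒m%n≡m (ℕ.>-nonZero⁻¹ m) ⟨
        0 % m                     ∎)
        where open ≡-Reasoning

    prodExp-mod : ∀ s x y → + prodExp s x y ≡ + x + signed s (+ y) [mod m ]
    prodExp-mod false x y = mod-reflexive (pos-+ x y)
    prodExp-mod true  x y = mod-trans (mod-reflexive (pos-+ x (negExp y))) (mod-+ {a = + x} {b = + x} mod-refl (negExp-mod y))

    invExp-mod : ∀ s x → + invExp s x ≡ signed (not s) (+ x) [mod m ]
    invExp-mod false x = negExp-mod x
    invExp-mod true  x = mod-refl

module Subgroups where

  open import Defs
  open Congruence
  open Dihedral
  open import Data.Nat as ℕ using (ℕ; NonZero; _%_; _≤_; _<_; _≟_; z≤n; s≤s)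
  open import Data.Nat.Properties using (<-≤-trans; +-identityʳ)
  open import Data.Nat.DivMod using (m<n⇒m%n≡m; m∣n⇒o%n%m≡o%m)
  open import Data.Nat.Divisibility using (_∣_; ∣-antisym; m%n≡0⇒n∣m)
  open import Data.Fin using (toℕ)
  open import Data.Fin.Subset using (Subset; _∈_; ⊤)
  open import Data.Fin.Subset.Properties using (∈⊤)
  open import Data.Vec using (lookup; tabulate)
  open import Data.Vec.Properties using (lookup∘tabulate; []=⇒lookup; lookup⇒[]=)
  open import Data.Integer using (+_; _+_; -_)
  open import Data.Integer.Tactic.RingSolver using (solve-∀)
  open import Data.Bool using (Bool; true; false; _xor_; not)
  open import Data.Product using (_×_; _,_; proj₁; proj₂)
  open import Relation.Binary.PropositionalEquality
  open import Relation.Nullary using (Dec; yes; no; does; ¬_)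
  open import Relation.Nullary.Decidable using (dec-true)

  -- The offset of the coset b^s in ⟨a^d, a^i b⟩: exponents of a^x b^s in it satisfy x ≡ offset i s (mod d).
  offset : ℕ → Bool → ℕ
  offset i false = 0
  offset i true  = i

  offset-xor : ∀ i s t → + offset i s + signed s (+ offset i t) ≡ + offset i (s xor t)
  offset-xor i false false = refl
  offset-xor i false true  = refl
  offset-xor i true  false = cong +_ (+-identityʳ i)
  offset-xor i true  true  = cancel (+ i)
    where cancel : ∀ a → a + - a ≡ + 0
          cancel = solve-∀

  offset-inv : ∀ i s → signed (not s) (+ offset i s) ≡ + offset i s
  offset-inv i false = refl
  offset-inv i true  = refl

  private
    fromDoes : ∀ {P : Set} (P? : Dec P) → does P? ≡ true → P
    fromDoes (yes p) _ = p
    fromDoes (no _) ()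

  module _ (m : ℕ) .{{_ : NonZero m}} where
    open FinGroup (Dih m)

    -- Sub d i = ⟨a^d, a^i b⟩ = { a^x b^s | x ≡ offset i s (mod d) }.
    Sub : (d i : ℕ) .{{_ : NonZero d}} → Subset (m ℕ.+ m)
    Sub d i = tabulate λ g → does (toℕ (proj₁ (dec m g)) % d ≟ offset i (proj₂ (dec m g)))

    module SubProperties (d i : ℕ) {{_ : NonZero d}} (d∣m : d ∣ m) (i<d : i < d) where

      private
        offset-reduced : ∀ s → offset i s % d ≡ offset i s
        offset-reduced false = m<n⇒m%n≡m (ℕ.>-nonZero⁻¹ d)
        offset-reduced true  = m<n⇒m%n≡m i<d

        -- The residue modulo d of a^x b^s is well defined because d ∣ m.
        lookup-E : ∀ x s → lookup (Sub d i) (E m x s) ≡ does (x % d ≟ offset i s)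
        lookup-E x s = begin
          lookup (Sub d i) (E m x s)                       ≡⟨ lookup∘tabulate _ (E m x s) ⟩
          does (toℕ (proj₁ (dec m (E m x s))) % d ≟ offset i (proj₂ (dec m (E m x s))))
            ≡⟨ cong (λ z → does (toℕ (proj₁ z) % d ≟ offset i (proj₂ z))) (dec-enc m (modm m x , s)) ⟩
          does (toℕ (modm m x) % d ≟ offset i s)
            ≡⟨ cong (λ r → does (r % d ≟ offset i s)) (toℕ-modm m x) ⟩
          does (x % m % d ≟ offset i s)                    ≡⟨ cong (λ r → does (r ≟ offset i s)) (m∣n⇒o%n%m≡o%m d m x d∣m) ⟩
          does (x % d ≟ offset i s)                        ∎
          where open ≡-Reasoning

      ∈Sub⇒ : ∀ {x s} → E m x s ∈ Sub d i → + x ≡ + offset i s [mod d ]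
      ∈Sub⇒ {x} {s} x∈ = %⇒mod (trans (fromDoes (x % d ≟ offset i s) (trans (sym (lookup-E x s)) ([]=⇒lookup x∈)))
                                      (sym (offset-reduced s)))

      ⇒∈Sub : ∀ {x s} → + x ≡ + offset i s [mod d ] → E m x s ∈ Sub d i
      ⇒∈Sub {x} {s} c = lookup⇒[]= _ _ (trans (lookup-E x s)
                          (dec-true (x % d ≟ offset i s) (trans (mod⇒% c) (offset-reduced s))))

      Sub-subgroup : IsSubgroup (Dih m) (Sub d i)
      Sub-subgroup = record
        { has-e   = ⇒∈Sub {0} {false} mod-refl
        ; closed· = elimE m _ λ x s → elimE m _ λ y t → closed x s y t
        ; closed⁻ = elimE m _ inverse }
        where
        closed : ∀ x s y t → E m x s ∈ Sub d i → E m y t ∈ Sub d i → E m x s · E m y t ∈ Sub d i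
        closed x s y t x∈ y∈ = subst (_∈ Sub d i) (sym (mul-E m x s y t))
          (⇒∈Sub (mod-trans (mod-divisor d∣m (prodExp-mod m s x y))
            (mod-trans (mod-+ (∈Sub⇒ x∈) (signed-mod s (∈Sub⇒ y∈))) (mod-reflexive (offset-xor i s t)))))
        inverse : ∀ x s → E m x s ∈ Sub d i → E m x s ⁻¹ ∈ Sub d i
        inverse x s x∈ = subst (_∈ Sub d i) (sym (inv-E m x s))
          (⇒∈Sub (mod-trans (mod-divisor d∣m (invExp-mod m s x))
            (mod-trans (signed-mod (not s) (∈Sub⇒ x∈)) (mod-reflexive (offset-inv i s)))))

      -- For d ≥ 3 the subgroup is a vertex of Γ_N(D_m): a ∉ Sub d i, and
      -- conjugating a^i b by a gives a^(i+2) b ∉ Sub d i.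
      module _ (3≤d : 3 ≤ d) where

        Sub-proper : Sub d i ≢ ⊤
        Sub-proper Sub≡⊤ with mod-residue (<-≤-trans (s≤s (s≤s z≤n)) 3≤d) (<-≤-trans (s≤s z≤n) 3≤d)
                                (∈Sub⇒ {1} {false} (subst (E m 1 false ∈_) (sym Sub≡⊤) ∈⊤))
        ... | ()

        Sub-nonNormal : ¬ IsNormal (Dih m) (Sub d i)
        Sub-nonNormal normal with mod-residue (<-≤-trans (s≤s (s≤s (s≤s z≤n))) 3≤d) (<-≤-trans (s≤s z≤n) 3≤d) 2≡0
          where
          conj≡ : (E m 1 false · E m i true) · (E m 1 false ⁻¹) ≡ E m (prodExp m true (1 ℕ.+ i) (negExp m 1)) true
          conj≡ = trans (cong ((E m 1 false · E m i true) ·_) (inv-E m 1 false))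
                    (trans (cong (_· E m (negExp m 1) false) (mul-E m 1 false i true)) (mul-E m (1 ℕ.+ i) true (negExp m 1) false))
          conj∈ : + prodExp m true (1 ℕ.+ i) (negExp m 1) ≡ + i [mod d ]
          conj∈ = ∈Sub⇒ (subst (_∈ Sub d i) conj≡ (normal (E m 1 false) (E m i true) (⇒∈Sub {i} {true} mod-refl)))
          conj-exp : + prodExp m true (1 ℕ.+ i) (negExp m 1) ≡ + 2 + + i [mod d ]
          conj-exp = mod-trans (mod-divisor d∣m (prodExp-mod m true (1 ℕ.+ i) (negExp m 1)))
                       (mod-trans (mod-+ (mod-refl {a = + (1 ℕ.+ i)}) (mod-neg (mod-divisor d∣m (negExp-mod m 1))))
                         (mod-reflexive (identity (+ i))))
            where identity : ∀ a → + 1 + a + - (- (+ 1)) ≡ + 2 + a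
                  identity = solve-∀
          2≡0 : + 2 ≡ + 0 [mod d ]
          2≡0 = mod-trans (mod-reflexive (sym (cancel (+ 2) (+ i))))
                  (mod-trans (mod-+ (mod-trans (mod-sym conj-exp) conj∈) (mod-refl {a = - + i})) (mod-reflexive (cancel′ (+ i))))
            where cancel : ∀ a b → a + b + - b ≡ a
                  cancel = solve-∀
                  cancel′ : ∀ a → a + - a ≡ + 0
                  cancel′ = solve-∀
        ... | ()

        Sub-vertex : IsVertex (Dih m) (Sub d i)
        Sub-vertex = Sub-subgroup , Sub-proper , Sub-nonNormal

    -- The parameters are determined by the subgroup: a^d and a^e lie in both
    -- subgroups, so d ∣ e ∣ d, and a^i b ∈ Sub e j gives i ≡ j (mod e).
    Sub-injective : ∀ d i e j {{_ : NonZero d}} {{_ : NonZero e}} (d∣m : d ∣ m) (i<d : i < d) (e∣m : e ∣ m) (j<e : j < e) →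
                    Sub d i ≡ Sub e j → d ≡ e × i ≡ j
    Sub-injective d i e j d∣m i<d e∣m j<e eq = d≡e , mod-residue (subst (i <_) d≡e i<d) j<e i≡j
      where
      module D = SubProperties d i d∣m i<d
      module F = SubProperties e j e∣m j<e
      divides-mod : ∀ {n x} .{{_ : NonZero n}} → + x ≡ + 0 [mod n ] → n ∣ x
      divides-mod {n} {x} c = m%n≡0⇒n∣m x n (trans (mod⇒% c) (m<n⇒m%n≡m (ℕ.>-nonZero⁻¹ n)))
      d≡e : d ≡ e
      d≡e = ∣-antisym (divides-mod (D.∈Sub⇒ {e} {false} (subst (E m e false ∈_) (sym eq) (F.⇒∈Sub mod-self))))
                      (divides-mod (F.∈Sub⇒ {d} {false} (subst (E m d false ∈_) eq (D.⇒∈Sub mod-self))))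
      i≡j : + i ≡ + j [mod e ]
      i≡j = F.∈Sub⇒ {i} {true} (subst (E m i true ∈_) eq (D.⇒∈Sub {i} {true} mod-refl))

module Permutability where

  open import Defs
  open Congruence
  open Dihedral
  open Subgroups
  open import Data.Nat as ℕ using (ℕ; NonZero; _<_)
  open import Data.Nat.Divisibility using (_∣_)
  open import Data.Integer using (ℤ; +_; _+_; _*_; -_; _-_)
  open import Data.Integer.Properties using (+-comm)
  open import Data.Integer.Tactic.RingSolver using (solve-∀)
  open import Data.Bool using (true; false; _xor_)
  open import Data.Bool.Properties using (xor-comm)
  open import Data.Product using (Σ; _×_; _,_; proj₁)
  open import Data.Fin.Subset using (Subset; _∈_)
  open import Relation.Binary.PropositionalEquality

  -- The arithmetic condition for ⟨a^d, a^i b⟩ and ⟨a^e, a^j b⟩ to permute: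
  -- 2i ≡ 2j modulo the subgroup of ℤ generated by d, e and m.
  record Compatible (m d i e j : ℕ) : Set where
    constructor compatible
    field
      k l  : ℤ
      congruence : + 2 * + i ≡ + 2 * + j + k * + d + l * + e [mod m ]

  compatible-sym : ∀ {m d i e j} → Compatible m d i e j → Compatible m e j d i
  compatible-sym {m} {d} {i} {e} {j} (compatible k l c) = compatible (- l) (- k) (
    mod-trans (mod-reflexive (rearrange (+ j) (+ d) (+ e) k l))
      (mod-+ (mod-+ (mod-sym c) (mod-refl {a = (- l) * + e})) (mod-refl {a = (- k) * + d})))
    where rearrange : ∀ J D E k l → + 2 * J ≡ (+ 2 * J + k * D + l * E) + (- l) * E + (- k) * D
          rearrange = solve-∀

  module _ (m : ℕ) {{_ : NonZero m}} where
    open FinGroup (Dih m)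

    commute-E : ∀ x s y t x' y' → + x + signed s (+ y) ≡ + y' + signed t (+ x') [mod m ] →
                E m x s · E m y t ≡ E m y' t · E m x' s
    commute-E x s y t x' y' c = begin
      E m x s · E m y t                  ≡⟨ mul-E m x s y t ⟩
      E m (prodExp m s x y) (s xor t)    ≡⟨ cong (E m (prodExp m s x y)) (xor-comm s t) ⟩
      E m (prodExp m s x y) (t xor s)    ≡⟨ E-mod m (t xor s) exponents ⟩
      E m (prodExp m t y' x') (t xor s)  ≡⟨ mul-E m y' t x' s ⟨
      E m y' t · E m x' s                ∎
      where
      open ≡-Reasoning
      exponents : + prodExp m s x y ≡ + prodExp m t y' x' [mod m ]
      exponents = mod-trans (prodExp-mod m s x y) (mod-trans c (mod-sym (prodExp-mod m t y' x')))

    module Permutation (d i e j : ℕ) {{_ : NonZero d}} {{_ : NonZero e}}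
                       (d∣m : d ∣ m) (i<d : i < d) (e∣m : e ∣ m) (j<e : j < e) where
      H₁ H₂ : Subset (m ℕ.+ m)
      H₁ = Sub m d i
      H₂ = Sub m e j
      module H₁ = SubProperties m d i d∣m i<d
      module H₂ = SubProperties m e j e∣m j<e

      -- The only non-trivial exchange: a product of two reflections a^x b ∈ H₁,
      -- a^y b ∈ H₂ is the rotation a^(x-y), which must be rewritten as
      -- (a^y' b)(a^x' b) = a^(y'-x') with a^x' b ∈ H₁ and a^y' b ∈ H₂.
      -- Writing x = i + αd, y = j + βe and 2i = 2j + kd + le + qm, the choice
      -- x' = x - (k + 2α)d, y' = y + (l - 2β)e works.
      exchange-reflections : Compatible m d i e j → ∀ x y → + x ≡ + i [mod d ] → + y ≡ + j [mod e ] →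
        Σ ℕ λ x' → Σ ℕ λ y' → + x' ≡ + i [mod d ] × + y' ≡ + j [mod e ] × + x - + y ≡ + y' - + x' [mod m ]
      exchange-reflections (compatible k l (witness q compat)) x y (witness α x≡) (witness β y≡) =
        x' , y' , x'≡i , y'≡j , exponent
        where
        A B : ℤ
        A = k + + 2 * α
        B = l - + 2 * β
        x' y' : ℕ
        x' = residue m (+ x - A * + d)
        y' = residue m (+ y + B * + e)
        x'≡i : + x' ≡ + i [mod d ]
        x'≡i = mod-trans (mod-divisor d∣m (residue-mod m _))
                 (mod-trans (mod-+ (mod-refl {a = + x}) (mod-neg (mod-multiple A)))
                   (mod-trans (mod-reflexive (plus-zero (+ x))) (witness α x≡)))
          where plus-zero : ∀ a → a - + 0 ≡ a
                plus-zero = solve-∀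
        y'≡j : + y' ≡ + j [mod e ]
        y'≡j = mod-trans (mod-divisor e∣m (residue-mod m _))
                 (mod-trans (mod-+ (mod-refl {a = + y}) (mod-multiple B))
                   (mod-trans (mod-reflexive (plus-zero (+ y))) (witness β y≡)))
          where plus-zero : ∀ a → a + + 0 ≡ a
                plus-zero = solve-∀
        T : ℤ
        T = + 2 * + j + k * + d + l * + e
        exponent-eq : + x - + y ≡ ((+ y + B * + e) - (+ x - A * + d)) + q * + m
        exponent-eq = begin
          + x - + y
            ≡⟨ cong₂ _-_ x≡ y≡ ⟩
          (+ i + α * + d) - (+ j + β * + e)
            ≡⟨ expand (+ i) (+ j) α β (+ d) (+ e) k l ⟩
          ((+ j + β * + e) + B * + e) - ((+ i + α * + d) - A * + d) + (+ 2 * + i - T)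
            ≡⟨ cong (λ z → ((+ j + β * + e) + B * + e) - ((+ i + α * + d) - A * + d) + (z - T)) compat ⟩
          ((+ j + β * + e) + B * + e) - ((+ i + α * + d) - A * + d) + ((T + q * + m) - T)
            ≡⟨ cancel (((+ j + β * + e) + B * + e) - ((+ i + α * + d) - A * + d)) T (q * + m) ⟩
          ((+ j + β * + e) + B * + e) - ((+ i + α * + d) - A * + d) + q * + m
            ≡⟨ cong₂ (λ u v → (u + B * + e) - (v - A * + d) + q * + m) (sym y≡) (sym x≡) ⟩
          ((+ y + B * + e) - (+ x - A * + d)) + q * + m  ∎
          where
          open ≡-Reasoning
          expand : ∀ I J α β D E k l → (I + α * D) - (J + β * E)
                   ≡ ((J + β * E) + (l - + 2 * β) * E) - ((I + α * D) - (k + + 2 * α) * D)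
                     + (+ 2 * I - (+ 2 * J + k * D + l * E))
          expand = solve-∀
          cancel : ∀ X T Q → X + ((T + Q) - T) ≡ X + Q
          cancel = solve-∀
        exponent : + x - + y ≡ + y' - + x' [mod m ]
        exponent = mod-trans (witness q exponent-eq)
          (mod-+ (mod-sym (residue-mod m (+ y + B * + e))) (mod-neg (mod-sym (residue-mod m (+ x - A * + d)))))

      exchange : Compatible m d i e j → ∀ x s y t → E m x s ∈ H₁ → E m y t ∈ H₂ → InProd (Dih m) H₂ H₁ (E m x s · E m y t)
      exchange c x false y false x∈ y∈ =
        E m y false , E m x false , y∈ , x∈ , commute-E x false y false x y (mod-reflexive (+-comm (+ x) (+ y)))
      exchange c x false y true x∈ y∈ =
        E m y true , E m (negExp m x) false , y∈ , H₁.⇒∈Sub (negate-rotation d∣m (H₁.∈Sub⇒ x∈)) ,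
        commute-E x false y true (negExp m x) y
          (mod-trans (mod-reflexive (+-comm (+ x) (+ y)))
            (mod-+ (mod-refl {a = + y}) (mod-trans (mod-reflexive (double-neg (+ x))) (mod-neg (mod-sym (negExp-mod m x))))))
        where double-neg : ∀ a → a ≡ - (- a)
              double-neg = solve-∀
              negate-rotation : ∀ {n x} → n ∣ m → + x ≡ + 0 [mod n ] → + negExp m x ≡ + 0 [mod n ]
              negate-rotation n∣m c = mod-trans (mod-divisor n∣m (negExp-mod m _)) (mod-neg c)
      exchange c x true y false x∈ y∈ =
        E m (negExp m y) false , E m x true , H₂.⇒∈Sub {negExp m y} {false} (mod-trans (mod-divisor e∣m (negExp-mod m y)) (mod-neg (H₂.∈Sub⇒ {y} {false} y∈))) , x∈ ,
        commute-E x true y false x (negExp m y)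
          (mod-trans (mod-reflexive (+-comm (+ x) (- + y))) (mod-+ (mod-sym (negExp-mod m y)) (mod-refl {a = + x})))
      exchange c x true y true x∈ y∈ with exchange-reflections c x y (H₁.∈Sub⇒ x∈) (H₂.∈Sub⇒ y∈)
      ... | x' , y' , x'≡i , y'≡j , exponent =
        E m y' true , E m x' true , H₂.⇒∈Sub y'≡j , H₁.⇒∈Sub x'≡i , commute-E x true y true x' y' exponent

      H₁H₂⊆H₂H₁ : Compatible m d i e j → ∀ g → InProd (Dih m) H₁ H₂ g → InProd (Dih m) H₂ H₁ g
      H₁H₂⊆H₂H₁ c g (h , k , h∈ , k∈ , refl) =
        elimE m (λ h → h ∈ H₁ → InProd (Dih m) H₂ H₁ (h · k))
          (λ x s x∈ → elimE m (λ k → k ∈ H₂ → InProd (Dih m) H₂ H₁ (E m x s · k))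
            (λ y t y∈ → exchange c x s y t x∈ y∈) k k∈) h h∈

      -- Conversely, if H₁H₂ = H₂H₁ then (a^i b)(a^j b) = a^(i-j) is a product
      -- (a^y b^t)(a^x b^s) ∈ H₂H₁; comparing exponents yields compatibility.
      compatible-from : ∀ y t x s → E m y t ∈ H₂ → E m x s ∈ H₁ →
                        E m i true · E m j true ≡ E m y t · E m x s → Compatible m d i e j
      compatible-from y t x s y∈ x∈ eq
        with E-injective m {prodExp m true i j} {prodExp m t y x} {false} {t xor s} (trans (sym (mul-E m i true j true)) (trans eq (mul-E m y t x s)))
      compatible-from y false x false y∈ x∈ eq | exps , _ with H₁.∈Sub⇒ x∈ | H₂.∈Sub⇒ y∈
      ... | witness α x≡ | witness β y≡ = compatible (+ 2 * α) (+ 2 * β) (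
        mod-trans (mod-reflexive (split (+ i) (+ j)))
          (mod-trans (mod-+ (mod-*ˡ (+ 2) i-j≡y+x) (mod-refl {a = + 2 * + j}))
            (mod-reflexive (trans (cong₂ (λ u v → + 2 * (u + v) + + 2 * + j) y≡ x≡) (collect (+ j) α β (+ d) (+ e))))))
        where
        split : ∀ I J → + 2 * I ≡ + 2 * (I - J) + + 2 * J
        split = solve-∀
        collect : ∀ J α β D E → + 2 * ((+ 0 + β * E) + (+ 0 + α * D)) + + 2 * J ≡ + 2 * J + (+ 2 * α) * D + (+ 2 * β) * E
        collect = solve-∀
        i-j≡y+x : + i - + j ≡ + y + + x [mod m ]
        i-j≡y+x = mod-trans (mod-sym (prodExp-mod m true i j)) (mod-trans exps (prodExp-mod m false y x))
      compatible-from y false x true y∈ x∈ eq | _ , ()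
      compatible-from y true x false y∈ x∈ eq | _ , ()
      compatible-from y true x true y∈ x∈ eq | exps , _ with H₁.∈Sub⇒ x∈ | H₂.∈Sub⇒ y∈
      ... | witness α x≡ | witness β y≡ = compatible (- α) β (
        mod-trans (mod-reflexive (split (+ i) (+ j)))
          (mod-trans (mod-+ (mod-+ (mod-refl {a = + i - + j}) i-j≡y-x) (mod-refl {a = + 2 * + j}))
            (mod-reflexive (trans (cong₂ (λ u v → (+ i - + j) + (u - v) + + 2 * + j) y≡ x≡) (collect (+ i) (+ j) α β (+ d) (+ e))))))
        where
        split : ∀ I J → + 2 * I ≡ (I - J) + (I - J) + + 2 * J
        split = solve-∀
        collect : ∀ I J α β D E → (I - J) + ((J + β * E) - (I + α * D)) + + 2 * J ≡ + 2 * J + (- α) * D + β * E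
        collect = solve-∀
        i-j≡y-x : + i - + j ≡ + y - + x [mod m ]
        i-j≡y-x = mod-trans (mod-sym (prodExp-mod m true i j)) (mod-trans exps (prodExp-mod m true y x))

      permute⇒compatible : Permute (Dih m) H₁ H₂ → Compatible m d i e j
      permute⇒compatible H₁H₂=H₂H₁
        with proj₁ (H₁H₂=H₂H₁ (E m i true · E m j true)) (E m i true , E m j true , H₁.⇒∈Sub {i} {true} mod-refl , H₂.⇒∈Sub {j} {true} mod-refl , refl)
      ... | k , h , k∈ , h∈ , eq =
        elimE m (λ k → k ∈ H₂ → h ∈ H₁ → E m i true · E m j true ≡ k · h → Compatible m d i e j)
          (λ y t → elimE m (λ h → E m y t ∈ H₂ → h ∈ H₁ → E m i true · E m j true ≡ E m y t · h → Compatible m d i e j)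
             (λ x s y∈ x∈ → compatible-from y t x s y∈ x∈) h) k k∈ h∈ eq

    permute⇔compatible : ∀ d i e j {{_ : NonZero d}} {{_ : NonZero e}} (d∣m : d ∣ m) (i<d : i < d) (e∣m : e ∣ m) (j<e : j < e) →
      (Permute (Dih m) (Sub m d i) (Sub m e j) → Compatible m d i e j) ×
      (Compatible m d i e j → Permute (Dih m) (Sub m d i) (Sub m e j))
    permute⇔compatible d i e j d∣m i<d e∣m j<e =
      Permutation.permute⇒compatible d i e j d∣m i<d e∣m j<e ,
      λ c g → Permutation.H₁H₂⊆H₂H₁ d i e j d∣m i<d e∣m j<e c g ,
              Permutation.H₁H₂⊆H₂H₁ e j d i e∣m j<e d∣m i<d (compatible-sym c) g

module Classification where

  open import Defs
  open Congruence
  open Dihedral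
  open Subgroups
  open import Data.Nat as ℕ using (ℕ; zero; suc; NonZero; _%_; _/_; _≤_; _<_; _≟_; _≤?_; z≤n; s≤s)
  open import Data.Nat.Properties using (+-identityʳ; +-suc; m+[n∸m]≡n; m≤n⇒m≤1+n; m<1+n⇒m<n∨m≡n; <⇒≱; ≰⇒>)
  open import Data.Nat.DivMod using (m<n⇒m%n≡m; m%n%n≡m%n; m%n<n; m≡m%n+[m/n]*n)
  open import Data.Nat.Divisibility using (_∣_; divides; m%n≡0⇒n∣m)
  open import Data.Fin using (Fin; toℕ)
  open import Data.Fin.Properties using (any?)
  open import Data.Fin.Subset using (Subset; _∈_)
  open import Data.Fin.Subset.Properties using (_∈?_; ⊆-antisym)
  open import Data.Integer using (+_; _+_; _*_; -_; _-_)
  open import Data.Integer.Properties using (pos-+; pos-*)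
  open import Data.Integer.Tactic.RingSolver using (solve-∀)
  open import Data.Bool using (true; false; _xor_; not)
  open import Data.Product using (Σ; _×_; _,_; proj₁; proj₂)
  open import Data.Sum using (inj₁; inj₂)
  open import Data.Empty using (⊥-elim)
  open import Relation.Binary.PropositionalEquality
  open import Relation.Nullary using (Dec; yes; no; ¬_)

  least-positive : (P : ℕ → Set) → (∀ x → Dec (P x)) → ∀ b → 1 ≤ b → P b →
                   Σ ℕ λ d → 1 ≤ d × P d × (∀ y → 1 ≤ y → y < d → ¬ P y)
  least-positive P P? b 1≤b Pb = search 1 (b ℕ.∸ 1) (m+[n∸m]≡n 1≤b) (s≤s z≤n) (λ y 1≤y y<1 → ⊥-elim (<⇒≱ y<1 1≤y))
    where
    -- Invariant: no witness in [1, k) and k + r = b, so the scan stops by b.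
    search : ∀ k r → k ℕ.+ r ≡ b → 1 ≤ k → (∀ y → 1 ≤ y → y < k → ¬ P y) →
             Σ ℕ λ d → 1 ≤ d × P d × (∀ y → 1 ≤ y → y < d → ¬ P y)
    search k r k+r≡b 1≤k below with P? k
    ... | yes Pk = k , 1≤k , Pk , below
    search k zero    k+r≡b 1≤k below | no ¬Pk = ⊥-elim (¬Pk (subst P (sym (trans (sym (+-identityʳ k)) k+r≡b)) Pb))
    search k (suc r) k+r≡b 1≤k below | no ¬Pk =
      search (suc k) r (trans (sym (+-suc k r)) k+r≡b) (m≤n⇒m≤1+n 1≤k) below′
      where
      below′ : ∀ y → 1 ≤ y → y < suc k → ¬ P y
      below′ y 1≤y y<1+k with m<1+n⇒m<n∨m≡n y<1+k
      ... | inj₁ y<k  = below y 1≤y y<k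
      ... | inj₂ refl = ¬Pk

  divisor-of-2 : ∀ {d} → d ∣ 2 → ∀ x → + 2 * x ≡ + 0 [mod d ]
  divisor-of-2 {d} (divides c 2≡cd) x =
    witness (+ c * x) (trans (cong (_* x) (trans (cong +_ 2≡cd) (pos-* c d))) (reorder (+ c) x (+ d)))
    where reorder : ∀ c x d → (c * d) * x ≡ + 0 + (c * x) * d
          reorder = solve-∀

  module _ (m : ℕ) {{_ : NonZero m}} where
    open FinGroup (Dih m)

    conj-E : ∀ a s x t → (E m a s · E m x t) · (E m a s ⁻¹)
                         ≡ E m (prodExp m (s xor t) (prodExp m s a x) (invExp m s a)) ((s xor t) xor s)
    conj-E a s x t = trans (cong ((E m a s · E m x t) ·_) (inv-E m a s))
      (trans (cong (_· E m (invExp m s a) s) (mul-E m a s x t)) (mul-E m (prodExp m s a x) (s xor t) (invExp m s a) s))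

    conj-mod : ∀ a s x t → + prodExp m (s xor t) (prodExp m s a x) (invExp m s a)
                           ≡ (+ a + signed s (+ x)) + signed (s xor t) (signed (not s) (+ a)) [mod m ]
    conj-mod a s x t = mod-trans (prodExp-mod m (s xor t) _ _)
      (mod-+ (prodExp-mod m s a x) (signed-mod (s xor t) (invExp-mod m s a)))

    record SubParams (H : Subset (m ℕ.+ m)) : Set where
      field
        d i     : ℕ
        {{d≢0}} : NonZero d
        d∣m     : d ∣ m
        3≤d     : 3 ≤ d
        i<d     : i < d
        H≡Sub   : H ≡ Sub m d i

    module Classify (H : Subset (m ℕ.+ m)) (H-subgroup : IsSubgroup (Dih m) H) (H-nonNormal : ¬ IsNormal (Dih m) H) where
      open IsSubgroup H-subgroup

      Rotation Reflection : ℕ → Set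
      Rotation   x = E m x false ∈ H
      Reflection x = E m x true ∈ H

      rotation-m : Rotation m
      rotation-m = subst (_∈ H) (E-mod m false (mod-sym mod-self)) has-e

      -- d is the least positive exponent with a^d ∈ H (which exists as a^m = e ∈ H).
      private
        least : Σ ℕ λ d → 1 ≤ d × Rotation d × (∀ y → 1 ≤ y → y < d → ¬ Rotation y)
        least = least-positive Rotation (λ x → E m x false ∈? H) m (ℕ.>-nonZero⁻¹ m) rotation-m

      d : ℕ
      d = proj₁ least

      instance
        d≢0 : NonZero d
        d≢0 = ℕ.>-nonZero (proj₁ (proj₂ least))

      rotation-multiple : ∀ q → Rotation (q ℕ.* d)
      rotation-multiple zero    = has-e
      rotation-multiple (suc q) = subst (_∈ H) (mul-E m d false (q ℕ.* d) false)
                                    (closed· _ _ (proj₁ (proj₂ (proj₂ least))) (rotation-multiple q))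

      -- a^x ∈ H iff d ∣ x: otherwise a^(x mod d) ∈ H would undercut d.
      rotation⇒ : ∀ {x} → Rotation x → + x ≡ + 0 [mod d ]
      rotation⇒ {x} ax∈ with x % d ≟ 0
      ... | yes r≡0 = %⇒mod (trans r≡0 (sym (m<n⇒m%n≡m (ℕ.>-nonZero⁻¹ d))))
      ... | no r≢0 = ⊥-elim (proj₂ (proj₂ (proj₂ least)) (x % d) (ℕ.>-nonZero⁻¹ (x % d) {{ℕ.≢-nonZero r≢0}}) (m%n<n x d) remainder∈)
        where
        q : ℕ
        q = x / d
        minus-multiple : Rotation (negExp m (q ℕ.* d))
        minus-multiple = subst (_∈ H) (inv-E m (q ℕ.* d) false) (closed⁻ _ (rotation-multiple q))
        x≡r+qd : + x ≡ + (x % d) + + (q ℕ.* d)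
        x≡r+qd = trans (cong +_ (m≡m%n+[m/n]*n x d)) (pos-+ (x % d) _)
        exponent : + (x ℕ.+ negExp m (q ℕ.* d)) ≡ + (x % d) [mod m ]
        exponent = mod-trans (mod-reflexive (pos-+ x _)) (mod-trans (mod-+ (mod-refl {a = + x}) (negExp-mod m (q ℕ.* d)))
                     (mod-reflexive (trans (cong (_- + (q ℕ.* d)) x≡r+qd) (cancel (+ (x % d)) (+ (q ℕ.* d))))))
          where cancel : ∀ a b → (a + b) - b ≡ a
                cancel = solve-∀
        remainder∈ : Rotation (x % d)
        remainder∈ = subst (_∈ H) (trans (mul-E m x false _ false) (E-mod m false exponent)) (closed· _ _ ax∈ minus-multiple)

      ⇒rotation : ∀ {x} → + x ≡ + 0 [mod d ] → Rotation x
      ⇒rotation {x} c = subst Rotation (sym x≡qd) (rotation-multiple (x / d))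
        where x≡qd : x ≡ x / d ℕ.* d
              x≡qd = trans (m≡m%n+[m/n]*n x d) (cong (ℕ._+ x / d ℕ.* d) (trans (mod⇒% c) (m<n⇒m%n≡m (ℕ.>-nonZero⁻¹ d))))

      d∣m : d ∣ m
      d∣m = m%n≡0⇒n∣m m d (trans (mod⇒% (rotation⇒ rotation-m))
                                   (m<n⇒m%n≡m (ℕ.>-nonZero⁻¹ d)))

      conj-rotation : ∀ a s x → Rotation x → (E m a s · E m x false) · (E m a s ⁻¹) ∈ H
      conj-rotation a false x ax∈ = subst (_∈ H) (sym (conj-E a false x false))
        (⇒rotation (mod-trans (mod-divisor d∣m (conj-mod a false x false))
          (mod-trans (mod-reflexive (cancel (+ a) (+ x))) (rotation⇒ ax∈))))
        where cancel : ∀ a x → (a + x) + - a ≡ x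
              cancel = solve-∀
      conj-rotation a true x ax∈ = subst (_∈ H) (sym (conj-E a true x false))
        (⇒rotation (mod-trans (mod-divisor d∣m (conj-mod a true x false))
          (mod-trans (mod-reflexive (cancel (+ a) (+ x))) (mod-neg (rotation⇒ ax∈)))))
        where cancel : ∀ a x → (a - x) - a ≡ - x
              cancel = solve-∀

      -- A subgroup of rotations only is normal, so H contains a reflection.
      no-reflection⇒normal : ¬ (Σ (Fin m) λ r → Reflection (toℕ r)) → IsNormal (Dih m) H
      no-reflection⇒normal none = elimE m _ λ a s → elimE m _ λ x t → conj a s x t
        where
        conj : ∀ a s x t → E m x t ∈ H → (E m a s · E m x t) · (E m a s ⁻¹) ∈ H
        conj a s x false ax∈ = conj-rotation a s x ax∈
        conj a s x true ax∈ = ⊥-elim (none (modm m x ,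
          subst (_∈ H) (E-mod m true (%⇒mod (sym (trans (cong (_% m) (toℕ-modm m x)) (m%n%n≡m%n x m))))) ax∈))

      module WithReflection (r₀ : Fin m) (r₀∈ : Reflection (toℕ r₀)) where
        i₀ i : ℕ
        i₀ = toℕ r₀
        i  = i₀ % d

        i₀≡i : + i₀ ≡ + i [mod d ]
        i₀≡i = %⇒mod (sym (m%n%n≡m%n i₀ d))

        -- a^y b · a^i₀ b = a^(y - i₀) is a rotation of H.
        reflection⇒ : ∀ {y} → Reflection y → + y ≡ + i [mod d ]
        reflection⇒ {y} ay∈ = mod-trans (mod-trans (mod-reflexive (shift (+ y) (+ negExp m i₀)))
            (mod-trans (mod-+ (mod-trans (mod-reflexive (sym (pos-+ y (negExp m i₀)))) difference)
                              (mod-neg (mod-divisor d∣m (negExp-mod m i₀))))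
              (mod-reflexive (double-neg (+ i₀))))) i₀≡i
          where
          shift : ∀ y n → y ≡ (y + n) + - n
          shift = solve-∀
          double-neg : ∀ a → + 0 + - (- a) ≡ a
          double-neg = solve-∀
          difference : + (y ℕ.+ negExp m i₀) ≡ + 0 [mod d ]
          difference = rotation⇒ (subst (_∈ H) (mul-E m y true i₀ true) (closed· _ _ ay∈ r₀∈))

        ⇒reflection : ∀ {y} → + y ≡ + i [mod d ] → Reflection y
        ⇒reflection {y} c = subst (_∈ H) (trans (mul-E m z false i₀ true) (E-mod m true z+i₀≡y))
                              (closed· _ _ (⇒rotation z≡0) r₀∈)
          where
          z : ℕ
          z = y ℕ.+ negExp m i₀
          cancel : ∀ a → a + - a ≡ + 0
          cancel = solve-∀
          z≡0 : + z ≡ + 0 [mod d ]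
          z≡0 = mod-trans (mod-reflexive (pos-+ y (negExp m i₀)))
                  (mod-trans (mod-+ c (mod-divisor d∣m (negExp-mod m i₀)))
                    (mod-trans (mod-+ (mod-sym i₀≡i) (mod-refl {a = - + i₀})) (mod-reflexive (cancel (+ i₀)))))
          restore : ∀ y i → (y + - i) + i ≡ y
          restore = solve-∀
          z+i₀≡y : + (z ℕ.+ i₀) ≡ + y [mod m ]
          z+i₀≡y = mod-trans (mod-reflexive (trans (pos-+ z i₀) (cong (_+ + i₀) (pos-+ y (negExp m i₀)))))
                     (mod-trans (mod-+ (mod-+ (mod-refl {a = + y}) (negExp-mod m i₀)) (mod-refl {a = + i₀}))
                       (mod-reflexive (restore (+ y) (+ i₀))))

        -- If d ∣ 2 then conjugation fixes every residue class, so H would be normal.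
        d∣2⇒normal : d ∣ 2 → IsNormal (Dih m) H
        d∣2⇒normal d∣2 = elimE m _ λ a s → elimE m _ λ x t → conj a s x t
          where
          conj : ∀ a s x t → E m x t ∈ H → (E m a s · E m x t) · (E m a s ⁻¹) ∈ H
          conj a s x false ax∈ = conj-rotation a s x ax∈
          conj a false x true ax∈ = subst (_∈ H) (sym (conj-E a false x true))
            (⇒reflection (mod-trans (mod-divisor d∣m (conj-mod a false x true))
              (mod-trans (mod-reflexive (collect (+ a) (+ x)))
                (mod-trans (mod-+ (divisor-of-2 d∣2 (+ a)) (reflection⇒ ax∈)) (mod-reflexive (zero-left (+ i)))))))
            where collect : ∀ a x → (a + x) - (- a) ≡ + 2 * a + x
                  collect = solve-∀
                  zero-left : ∀ a → + 0 + a ≡ a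
                  zero-left = solve-∀
          conj a true x true ax∈ = subst (_∈ H) (sym (conj-E a true x true))
            (⇒reflection (mod-trans (mod-divisor d∣m (conj-mod a true x true))
              (mod-trans (mod-reflexive (collect (+ a) (+ x)))
                (mod-trans (mod-+ (divisor-of-2 d∣2 (+ a)) (mod-neg (reflection⇒ ax∈)))
                  (mod-trans (mod-reflexive (zero-left (+ i)))
                    (mod-trans (mod-sym (mod-+ (mod-refl {a = - + i}) (divisor-of-2 d∣2 (+ i))))
                      (mod-reflexive (restore (+ i)))))))))
            where collect : ∀ a x → (a - x) + a ≡ + 2 * a + (- x)
                  collect = solve-∀
                  zero-left : ∀ i → + 0 + - i ≡ - i + + 0
                  zero-left = solve-∀
                  restore : ∀ i → - i + + 2 * i ≡ i
                  restore = solve-∀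

        3≤d : 3 ≤ d
        3≤d with 3 ≤? d
        ... | yes 3≤d = 3≤d
        ... | no 3≰d = ⊥-elim (H-nonNormal (d∣2⇒normal (small-divides d (ℕ.>-nonZero⁻¹ d) (ℕ.s≤s⁻¹ (≰⇒> 3≰d)))))
          where small-divides : ∀ d → 1 ≤ d → d ≤ 2 → d ∣ 2
                small-divides 1 _ _ = divides 2 refl
                small-divides 2 _ _ = divides 1 refl
                small-divides (suc (suc (suc _))) _ (s≤s (s≤s ()))

        i<d : i < d
        i<d = m%n<n i₀ d

        private module S = SubProperties m d i d∣m i<d

        H≡Sub : H ≡ Sub m d i
        H≡Sub = ⊆-antisym (λ {g} → elimE m (λ g → g ∈ H → g ∈ Sub m d i) H⊆ g) (λ {g} → elimE m (λ g → g ∈ Sub m d i → g ∈ H) ⊆H g)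
          where
          H⊆ : ∀ x s → E m x s ∈ H → E m x s ∈ Sub m d i
          H⊆ x false ax∈ = S.⇒∈Sub (rotation⇒ ax∈)
          H⊆ x true ax∈ = S.⇒∈Sub (reflection⇒ ax∈)
          ⊆H : ∀ x s → E m x s ∈ Sub m d i → E m x s ∈ H
          ⊆H x false ax∈ = ⇒rotation (S.∈Sub⇒ ax∈)
          ⊆H x true ax∈ = ⇒reflection (S.∈Sub⇒ ax∈)

      classify : SubParams H
      classify with any? (λ r → E m (toℕ r) true ∈? H)
      ... | no none = ⊥-elim (H-nonNormal (no-reflection⇒normal none))
      ... | yes (r₀ , r₀∈) = record { d = d ; i = i ; d∣m = d∣m ; 3≤d = 3≤d ; i<d = i<d ; H≡Sub = H≡Sub }
        where open WithReflection r₀ r₀∈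

module GraphIso where

  open import Defs
  open import Data.Nat using (_+_)
  open import Data.Fin using (Fin; zero; splitAt; join)
  open import Data.Fin.Properties using (splitAt-join; join-splitAt)
  open import Data.Product using (_,_; proj₁)
  open import Data.Sum using (inj₁; inj₂)
  open import Data.Unit using (tt)
  open import Data.Empty using (⊥-elim)
  open import Relation.Binary.PropositionalEquality
  open import Relation.Nullary using (¬_)
  open import Function.Bundles using (mk⇔; mk↔ₛ′)
  open import Function.Properties.Inverse using (↔⇒⤖)

  -- Graph isomorphisms presented by a pair of mutually inverse maps; this is
  -- easier to compose than the bijection bundle used in _≅_.
  record GraphIso (G₁ G₂ : Graph) : Set where
    field
      to      : V G₁ → V G₂
      from    : V G₂ → V G₁
      from-to : ∀ x → from (to x) ≡ x
      to-from : ∀ y → to (from y) ≡ y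
      adj⇒    : ∀ u v → Adj G₁ u v → Adj G₂ (to u) (to v)
      adj⇐    : ∀ u v → Adj G₂ (to u) (to v) → Adj G₁ u v
  open GraphIso public

  GraphIso⇒≅ : ∀ {G₁ G₂} → GraphIso G₁ G₂ → G₁ ≅ G₂
  GraphIso⇒≅ I = record
    { f   = ↔⇒⤖ (mk↔ₛ′ (to I) (from I) (to-from I) (from-to I))
    ; adj = λ u v → mk⇔ (adj⇒ I u v) (adj⇐ I u v) }

  iso-refl : ∀ {G} → GraphIso G G
  iso-refl = record { to = λ x → x ; from = λ x → x ; from-to = λ _ → refl ; to-from = λ _ → refl
                    ; adj⇒ = λ _ _ a → a ; adj⇐ = λ _ _ a → a }

  iso-sym : ∀ {G₁ G₂} → GraphIso G₁ G₂ → GraphIso G₂ G₁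
  iso-sym {G₁} {G₂} I = record
    { to = from I ; from = to I ; from-to = to-from I ; to-from = from-to I
    ; adj⇒ = λ u v a → adj⇐ I (from I u) (from I v) (subst₂ (Adj G₂) (sym (to-from I u)) (sym (to-from I v)) a)
    ; adj⇐ = λ u v a → subst₂ (Adj G₂) (to-from I u) (to-from I v) (adj⇒ I (from I u) (from I v) a) }

  iso-trans : ∀ {G₁ G₂ G₃} → GraphIso G₁ G₂ → GraphIso G₂ G₃ → GraphIso G₁ G₃
  iso-trans I J = record
    { to = λ x → to J (to I x) ; from = λ y → from I (from J y)
    ; from-to = λ x → trans (cong (from I) (from-to J (to I x))) (from-to I x)
    ; to-from = λ y → trans (cong (to J) (to-from I (from J y))) (to-from J y)
    ; adj⇒ = λ u v a → adj⇒ J _ _ (adj⇒ I u v a)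
    ; adj⇐ = λ u v a → adj⇐ I u v (adj⇐ J _ _ a) }

  infixr 5 _⟫_
  _⟫_ : ∀ {G₁ G₂ G₃} → GraphIso G₁ G₂ → GraphIso G₂ G₃ → GraphIso G₁ G₃
  _⟫_ = iso-trans

  copies-cong : ∀ {n A B} → GraphIso A B → GraphIso (copies n A) (copies n B)
  copies-cong I = record
    { to = λ (c , u) → c , to I u ; from = λ (c , u) → c , from I u
    ; from-to = λ (c , u) → cong (c ,_) (from-to I u) ; to-from = λ (c , u) → cong (c ,_) (to-from I u)
    ; adj⇒ = λ (_ , u) (_ , v) (same , a) → same , adj⇒ I u v a
    ; adj⇐ = λ (_ , u) (_ , v) (same , a) → same , adj⇐ I u v a }

  ⊕-cong : ∀ {A A′ B B′} → GraphIso A A′ → GraphIso B B′ → GraphIso (A ⊕ B) (A′ ⊕ B′)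
  ⊕-cong {A} {A′} {B} {B′} I J = record
    { to = map I J ; from = map (iso-sym I) (iso-sym J) ; from-to = from-map ; to-from = to-map
    ; adj⇒ = preserve ; adj⇐ = reflect }
    where
    map : ∀ {A A′ B B′} → GraphIso A A′ → GraphIso B B′ → V (A ⊕ B) → V (A′ ⊕ B′)
    map I J (inj₁ u) = inj₁ (to I u)
    map I J (inj₂ u) = inj₂ (to J u)
    from-map : ∀ x → map (iso-sym I) (iso-sym J) (map I J x) ≡ x
    from-map (inj₁ u) = cong inj₁ (from-to I u)
    from-map (inj₂ u) = cong inj₂ (from-to J u)
    to-map : ∀ x → map I J (map (iso-sym I) (iso-sym J) x) ≡ x
    to-map (inj₁ u) = cong inj₁ (to-from I u)
    to-map (inj₂ u) = cong inj₂ (to-from J u)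
    preserve : ∀ u v → Adj (A ⊕ B) u v → Adj (A′ ⊕ B′) (map I J u) (map I J v)
    preserve (inj₁ u) (inj₁ v) a = adj⇒ I u v a
    preserve (inj₁ u) (inj₂ v) a = tt
    preserve (inj₂ u) (inj₁ v) a = tt
    preserve (inj₂ u) (inj₂ v) a = adj⇒ J u v a
    reflect : ∀ u v → Adj (A′ ⊕ B′) (map I J u) (map I J v) → Adj (A ⊕ B) u v
    reflect (inj₁ u) (inj₁ v) a = adj⇐ I u v a
    reflect (inj₁ u) (inj₂ v) a = tt
    reflect (inj₂ u) (inj₁ v) a = tt
    reflect (inj₂ u) (inj₂ v) a = adj⇐ J u v a

  empty-⊕ : ∀ {A B} → ¬ V A → GraphIso (A ⊕ B) B
  empty-⊕ {A} {B} ¬A = record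
    { to = drop ; from = inj₂ ; from-to = from-drop ; to-from = λ _ → refl ; adj⇒ = preserve ; adj⇐ = reflect }
    where
    drop : V (A ⊕ B) → V B
    drop (inj₁ u) = ⊥-elim (¬A u)
    drop (inj₂ u) = u
    from-drop : ∀ x → inj₂ (drop x) ≡ x
    from-drop (inj₁ u) = ⊥-elim (¬A u)
    from-drop (inj₂ u) = refl
    preserve : ∀ u v → Adj (A ⊕ B) u v → Adj B (drop u) (drop v)
    preserve (inj₁ u) _ _ = ⊥-elim (¬A u)
    preserve (inj₂ u) (inj₁ v) _ = ⊥-elim (¬A v)
    preserve (inj₂ u) (inj₂ v) a = a
    reflect : ∀ u v → Adj B (drop u) (drop v) → Adj (A ⊕ B) u v
    reflect (inj₁ u) _ _ = ⊥-elim (¬A u)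
    reflect (inj₂ u) (inj₁ v) _ = ⊥-elim (¬A v)
    reflect (inj₂ u) (inj₂ v) a = a

  K-join : ∀ a b → GraphIso (K a ⊕ K b) (K (a + b))
  K-join a b = record
    { to = join a b ; from = splitAt a ; from-to = splitAt-join a b ; to-from = join-splitAt a b
    ; adj⇒ = preserve ; adj⇐ = reflect }
    where
    join-injective : ∀ {u v} → join a b u ≡ join a b v → u ≡ v
    join-injective {u} {v} eq = trans (sym (splitAt-join a b u)) (trans (cong (splitAt a) eq) (splitAt-join a b v))
    preserve : ∀ u v → Adj (K a ⊕ K b) u v → join a b u ≢ join a b v
    preserve (inj₁ u) (inj₁ v) u≢v eq = u≢v (inj₁-injective (join-injective eq))
      where inj₁-injective : ∀ {x y : Fin a} → inj₁ {B = Fin b} x ≡ inj₁ y → x ≡ y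
            inj₁-injective refl = refl
    preserve (inj₂ u) (inj₂ v) u≢v eq = u≢v (inj₂-injective (join-injective eq))
      where inj₂-injective : ∀ {x y : Fin b} → inj₂ {A = Fin a} x ≡ inj₂ y → x ≡ y
            inj₂-injective refl = refl
    preserve (inj₁ u) (inj₂ v) _ eq with join-injective {inj₁ u} {inj₂ v} eq
    ... | ()
    preserve (inj₂ u) (inj₁ v) _ eq with join-injective {inj₂ u} {inj₁ v} eq
    ... | ()
    reflect : ∀ u v → join a b u ≢ join a b v → Adj (K a ⊕ K b) u v
    reflect (inj₁ u) (inj₁ v) ne refl = ne refl
    reflect (inj₁ u) (inj₂ v) _ = tt
    reflect (inj₂ u) (inj₁ v) _ = tt
    reflect (inj₂ u) (inj₂ v) ne refl = ne refl

  copies-K1 : ∀ p → GraphIso (copies p (K 1)) (Kbar p)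
  copies-K1 p = record
    { to = proj₁ ; from = λ c → c , zero ; from-to = λ { (c , zero) → refl } ; to-from = λ _ → refl
    ; adj⇒ = λ { (c , zero) (c′ , zero) (_ , ne) → ne refl } ; adj⇐ = λ _ _ () }

module ParameterGraph where

  open import Defs
  open Congruence
  open Subgroups
  open Permutability
  open Classification
  open GraphIso
  open import Data.Nat as ℕ using (ℕ; NonZero; _≤_; _<_; _≤?_; _<?_; z≤n; s≤s)
  open import Data.Nat.Properties using (≤-trans; <⇒≱)
  open import Data.Nat.Divisibility using (_∣_; _∣?_; ∣⇒≤)
  open import Data.Fin.Properties using (all?)
  open import Data.Fin.Subset using (Subset)
  open import Data.Fin.Subset.Properties using (_∈?_)
  open import Data.Product using (_×_; _,_; proj₁; proj₂)
  import Data.Empty.Irrelevant as Irrelevant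
  open import Relation.Binary.PropositionalEquality
  open import Relation.Nullary using (Dec; ¬_)
  open import Relation.Nullary.Decidable using (recompute; map′; _→-dec_; _×-dec_)

  -- Admissible parameters (d, i) of Sub d i: d ∣ m, d ≥ t and i < d.
  -- The proofs are irrelevant, so parameters are equal iff d and i are.
  record Param (t m : ℕ) : Set where
    constructor param
    field
      d i  : ℕ
      .d∣m : d ∣ m
      .t≤d : t ≤ d
      .i<d : i < d
  open Param public

  param-ext : ∀ {t m} {u v : Param t m} → d u ≡ d v → i u ≡ i v → u ≡ v
  param-ext {u = param _ _ _ _ _} {param _ _ _ _ _} refl refl = refl

  -- Graph on parameters, adjacency = compatibility; for t = 3 it is Γ_N(D_m).
  ParamGraph : ℕ → ℕ → Graph
  ParamGraph t m = record
    { V   = Param t m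
    ; Adj = λ u v → u ≢ v × Compatible m (d u) (i u) (d v) (i v) }

  -- No divisor of m exceeds m.
  no-params : ∀ {t m} .{{_ : NonZero m}} → m < t → ¬ Param t m
  no-params {t} {m} m<t (param d i d∣m t≤d i<d) =
    <⇒≱ m<t (≤-trans (recompute (t ≤? d) t≤d) (∣⇒≤ (recompute (d ∣? m) d∣m)))

  module _ (m : ℕ) {{_ : NonZero m}} where
    open FinGroup (Dih m)

    private
      vtx-ext : ∀ {u v : ΓVertex (Dih m)} → sub u ≡ sub v → u ≡ v
      vtx-ext {vtx H _} {vtx .H _} refl = refl

      nonZero : ∀ {d} → .(3 ≤ d) → NonZero d
      nonZero {d} 3≤d = ℕ.>-nonZero (≤-trans (s≤s z≤n) (recompute (3 ≤? d) 3≤d))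

      subgroup? : (H : Subset (m ℕ.+ m)) → Dec (IsSubgroup (Dih m) H)
      subgroup? H = map′ (λ (e∈ , closed· , closed⁻) → record { has-e = e∈ ; closed· = closed· ; closed⁻ = closed⁻ })
                         (λ s → IsSubgroup.has-e s , IsSubgroup.closed· s , IsSubgroup.closed⁻ s)
                         ((e ∈? H) ×-dec ((all? λ x → all? λ y → (x ∈? H) →-dec ((y ∈? H) →-dec ((x · y) ∈? H)))
                                          ×-dec all? λ x → (x ∈? H) →-dec ((x ⁻¹) ∈? H)))

      -- Vertex proofs are irrelevant; being a subgroup is decidable, so the
      -- classification can still be run on a vertex.
      params-of : (u : ΓVertex (Dih m)) → SubParams m (sub u)
      params-of (vtx H isV) = Classify.classify m H (recompute (subgroup? H) (proj₁ isV))
                                                     (λ normal → Irrelevant.⊥-elim (proj₂ (proj₂ isV) normal))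

    to-param : ΓVertex (Dih m) → Param 3 m
    to-param u = param (SubParams.d P) (SubParams.i P) (SubParams.d∣m P) (SubParams.3≤d P) (SubParams.i<d P)
      where P = params-of u

    from-param : Param 3 m → ΓVertex (Dih m)
    from-param (param d i d∣m 3≤d i<d) =
      vtx (Sub m d i {{nonZero 3≤d}}) (SubProperties.Sub-vertex m d i {{nonZero 3≤d}} d∣m i<d 3≤d)

    from-to-param : ∀ u → from-param (to-param u) ≡ u
    from-to-param u = vtx-ext (sym (SubParams.H≡Sub (params-of u)))

    to-from-param : ∀ p → to-param (from-param p) ≡ p
    to-from-param p@(param d i d∣m 3≤d i<d) = param-ext (sym (proj₁ same)) (sym (proj₂ same))
      where
      P : SubParams m (Sub m d i {{nonZero 3≤d}})
      P = params-of (from-param p)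
      same : d ≡ SubParams.d P × i ≡ SubParams.i P
      same = Sub-injective m d i (SubParams.d P) (SubParams.i P) {{nonZero 3≤d}} {{SubParams.d≢0 P}}
               (recompute (d ∣? m) d∣m) (recompute (i <? d) i<d) (SubParams.d∣m P) (SubParams.i<d P) (SubParams.H≡Sub P)

    private
      params-permute : ∀ {H K} (P : SubParams m H) (Q : SubParams m K) →
        (Permute (Dih m) H K → Compatible m (SubParams.d P) (SubParams.i P) (SubParams.d Q) (SubParams.i Q)) ×
        (Compatible m (SubParams.d P) (SubParams.i P) (SubParams.d Q) (SubParams.i Q) → Permute (Dih m) H K)
      params-permute record { d = d ; i = i ; d≢0 = d≢0 ; d∣m = d∣m ; i<d = i<d ; H≡Sub = refl }
                     record { d = e ; i = j ; d≢0 = e≢0 ; d∣m = e∣m ; i<d = j<e ; H≡Sub = refl } =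
        permute⇔compatible m d i e j {{d≢0}} {{e≢0}} d∣m i<d e∣m j<e

    Γ≅ParamGraph : GraphIso (Γ_N (Dih m)) (ParamGraph 3 m)
    Γ≅ParamGraph = record
      { to = to-param ; from = from-param ; from-to = from-to-param ; to-from = to-from-param
      ; adj⇒ = λ u v (u≢v , perm) →
          (λ eq → u≢v (cong sub (trans (sym (from-to-param u)) (trans (cong from-param eq) (from-to-param v))))) ,
          proj₁ (params-permute (params-of u) (params-of v)) perm
      ; adj⇐ = λ u v (u≢v , c) →
          (λ eq → u≢v (cong to-param {u} {v} (vtx-ext {u} {v} eq))) ,
          proj₂ (params-permute (params-of u) (params-of v)) c }

module Lifting where

  open Congruence
  open Permutability
  open import Data.Nat as ℕ using (ℕ; zero; suc; NonZero; _%_; _/_; _≤_; s≤s)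
  open import Data.Nat.DivMod using (m≡m%n+[m/n]*n; m%n<n)
  open import Data.Nat.Divisibility using (_∣_; divides; m%n≡0⇒n∣m)
  open import Data.Nat.Primality using (Prime; prime⇒irreducible)
  open import Data.Integer using (ℤ; +_; _+_; _*_; -_; _-_)
  open import Data.Integer.Properties using (pos-+; pos-*; *-cancelʳ-≡)
  open import Data.Integer.Tactic.RingSolver using (solve-∀)
  open import Data.Product using (Σ; _,_)
  open import Data.Sum using (inj₁; inj₂)
  open import Relation.Binary.PropositionalEquality

  scale⇒ : ∀ {n p X Y} → X ≡ Y [mod n ] → X * + p ≡ Y * + p [mod n ℕ.* p ]
  scale⇒ {n} {p} {X} {Y} (witness q refl) =
    witness q (trans (distrib Y q (+ n) (+ p)) (cong (λ z → Y * + p + q * z) (sym (pos-* n p))))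
    where distrib : ∀ Y q n p → (Y + q * n) * p ≡ Y * p + q * (n * p)
          distrib = solve-∀

  scale⇐ : ∀ {n p X Y} .{{_ : NonZero p}} → X * + p ≡ Y * + p [mod n ℕ.* p ] → X ≡ Y [mod n ]
  scale⇐ {n} {p} {X} {Y} (witness q eq) =
    witness q (*-cancelʳ-≡ X (Y + q * + n) (+ p) (trans eq (trans (cong (λ z → Y * + p + q * z) (pos-* n p)) (distrib Y q (+ n) (+ p)))))
    where distrib : ∀ Y q n p → Y * p + q * (n * p) ≡ (Y + q * n) * p
          distrib = solve-∀

  odd-prime : ∀ {p} → Prime p → 3 ≤ p → Σ ℕ λ h → p ≡ 1 ℕ.+ h ℕ.* 2
  odd-prime {p} p-prime 3≤p with p % 2 in p%2≡ | m%n<n p 2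
  ... | zero | _ with prime⇒irreducible p-prime (m%n≡0⇒n∣m p 2 p%2≡)
  ...   | inj₁ ()
  ...   | inj₂ refl with 3≤p
  ...     | s≤s (s≤s ())
  odd-prime {p} p-prime 3≤p | suc zero | _ = p / 2 , trans (m≡m%n+[m/n]*n p 2) (cong (ℕ._+ p / 2 ℕ.* 2) p%2≡)
  odd-prime {p} p-prime 3≤p | suc (suc _) | s≤s (s≤s ())

  -- 2 is invertible modulo an odd prime p = 1 + 2h, with inverse h + 1.
  halve : ∀ {p c c′} → Prime p → 3 ≤ p → + 2 * c ≡ + 2 * c′ [mod p ] → c ≡ c′ [mod p ]
  halve {p} {c} {c′} p-prime 3≤p 2c≡2c′ with odd-prime p-prime 3≤p
  ... | h , p≡ = mod-trans (mod-sym (inverse c)) (mod-trans (mod-*ˡ (+ h + + 1) 2c≡2c′) (inverse c′))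
    where
    P≡ : + p ≡ + 1 + + h * + 2
    P≡ = trans (cong +_ p≡) (trans (pos-+ 1 _) (cong (_+_ (+ 1)) (pos-* h 2)))
    expand : ∀ H C → (H + + 1) * (+ 2 * C) ≡ C + C * (+ 1 + H * + 2)
    expand = solve-∀
    inverse : ∀ x → (+ h + + 1) * (+ 2 * x) ≡ x [mod p ]
    inverse x = witness x (trans (expand (+ h) x) (cong (λ z → x + x * z) (sym P≡)))

  module Lift (p n m : ℕ) {{_ : NonZero p}} (m≡np : m ≡ n ℕ.* p) where

    private
      P : ℤ
      P = + p

      lifted : ∀ c i → + (c ℕ.+ i ℕ.* p) ≡ + c + + i * P
      lifted c i = trans (pos-+ c _) (cong (_+_ (+ c)) (pos-* i p))

      lifted-rhs : ∀ c j d e k l → + 2 * + (c ℕ.+ j ℕ.* p) + k * + (d ℕ.* p) + l * + (e ℕ.* p)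
                                  ≡ + 2 * (+ c + + j * P) + k * (+ d * P) + l * (+ e * P)
      lifted-rhs c j d e k l =
        trans (cong (λ u → + 2 * u + k * + (d ℕ.* p) + l * + (e ℕ.* p)) (lifted c j))
              (cong₂ (λ v w → + 2 * (+ c + + j * P) + k * v + l * w) (pos-* d p) (pos-* e p))


    unfold : ∀ {c c′ i′ j′ d′ e′} (C : Compatible m (d′ ℕ.* p) (c ℕ.+ i′ ℕ.* p) (e′ ℕ.* p) (c′ ℕ.+ j′ ℕ.* p)) →
             let open Compatible C in
             + 2 * (+ c + + i′ * P) ≡ + 2 * (+ c′ + + j′ * P) + k * (+ d′ * P) + l * (+ e′ * P) [mod m ]
    unfold {c} {c′} {i′} {j′} {d′} {e′} (compatible k l congruence) =
      mod-trans (mod-reflexive (sym (cong (+ 2 *_) (lifted c i′))))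
        (mod-trans congruence (mod-reflexive (lifted-rhs c′ j′ d′ e′ k l)))

    lift : ∀ c i′ j′ d′ e′ → Compatible n d′ i′ e′ j′ →
           Compatible m (d′ ℕ.* p) (c ℕ.+ i′ ℕ.* p) (e′ ℕ.* p) (c ℕ.+ j′ ℕ.* p)
    lift c i′ j′ d′ e′ (compatible k l congruence) = compatible k l
      (mod-trans (mod-reflexive (trans (cong (+ 2 *_) (lifted c i′)) (reorder (+ c) (+ i′) P)))
        (mod-trans (mod-+ (mod-modulus (sym m≡np) (scale⇒ congruence)) (mod-refl {a = + 2 * + c}))
          (mod-reflexive (trans (collect (+ c) (+ j′) P k l (+ d′) (+ e′)) (sym (lifted-rhs c j′ d′ e′ k l))))))
      where
      reorder : ∀ C I P → + 2 * (C + I * P) ≡ (+ 2 * I) * P + + 2 * C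
      reorder = solve-∀
      collect : ∀ C J P k l D E → (+ 2 * J + k * D + l * E) * P + + 2 * C ≡ + 2 * (C + J * P) + k * (D * P) + l * (E * P)
      collect = solve-∀

    descend : ∀ c i′ j′ d′ e′ → Compatible m (d′ ℕ.* p) (c ℕ.+ i′ ℕ.* p) (e′ ℕ.* p) (c ℕ.+ j′ ℕ.* p) →
              Compatible n d′ i′ e′ j′
    descend c i′ j′ d′ e′ C@(compatible k l _) = compatible k l (scale⇐ {p = p}
      (mod-trans (mod-reflexive (isolate (+ c) (+ i′) P))
        (mod-trans (mod-+ (mod-modulus m≡np (unfold {c} {c} {i′} {j′} {d′} {e′} C)) (mod-refl {a = - (+ 2 * + c)}))
          (mod-reflexive (collect (+ c) (+ j′) P k l (+ d′) (+ e′))))))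
      where
      isolate : ∀ C I P → (+ 2 * I) * P ≡ + 2 * (C + I * P) + - (+ 2 * C)
      isolate = solve-∀
      collect : ∀ C J P k l D E → + 2 * (C + J * P) + k * (D * P) + l * (E * P) + - (+ 2 * C) ≡ (+ 2 * J + k * D + l * E) * P
      collect = solve-∀

    -- For an odd prime p, lifted parameters can only be compatible when they
    -- have the same residue c: reduce modulo p and halve.
    same-residue-odd : Prime p → 3 ≤ p → ∀ {c c′ i′ j′ d′ e′} →
      Compatible m (d′ ℕ.* p) (c ℕ.+ i′ ℕ.* p) (e′ ℕ.* p) (c′ ℕ.+ j′ ℕ.* p) → + c ≡ + c′ [mod p ]
    same-residue-odd p-prime 3≤p {c} {c′} {i′} {j′} {d′} {e′} C@(compatible k l _) = halve p-prime 3≤p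
      (mod-trans (witness (- (+ 2 * + i′)) (drop-multiple (+ c) (+ i′) P))
        (mod-trans (mod-divisor (divides n m≡np) (unfold {c} {c′} {i′} {j′} {d′} {e′} C))
          (witness (+ 2 * + j′ + k * + d′ + l * + e′) (collect (+ c′) (+ j′) P k l (+ d′) (+ e′)))))
      where
      drop-multiple : ∀ C I P → + 2 * C ≡ + 2 * (C + I * P) + (- (+ 2 * I)) * P
      drop-multiple = solve-∀
      collect : ∀ C J P k l D E → + 2 * (C + J * P) + k * (D * P) + l * (E * P) ≡ + 2 * C + (+ 2 * J + k * D + l * E) * P
      collect = solve-∀

  -- For p = 2 the same holds provided d′, e′ and n are even: halve the modulus
  -- and reduce modulo 2.
  same-residue-two : ∀ n m → m ≡ n ℕ.* 2 → 2 ∣ n → ∀ {c c′ i′ j′ d′ e′} → 2 ∣ d′ → 2 ∣ e′ →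
    Compatible m (d′ ℕ.* 2) (c ℕ.+ i′ ℕ.* 2) (e′ ℕ.* 2) (c′ ℕ.+ j′ ℕ.* 2) → + c ≡ + c′ [mod 2 ]
  same-residue-two n m m≡2n 2∣n {c} {c′} {i′} {j′} {d′} {e′} (divides δ d′≡) (divides ε e′≡) C@(compatible k l _) =
    mod-trans (witness (- + i′) (drop (+ c) (+ i′)))
      (mod-trans (mod-divisor 2∣n halved)
        (witness (+ j′ + k * + δ + l * + ε) (trans (cong₂ (λ u v → + c′ + + j′ * + 2 + k * u + l * v) D≡ E≡)
                                                  (collect (+ c′) (+ j′) k l (+ δ) (+ ε)))))
    where
    open Lift 2 n m m≡2n using (unfold)
    D≡ : + d′ ≡ + δ * + 2
    D≡ = trans (cong +_ d′≡) (pos-* δ 2)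
    E≡ : + e′ ≡ + ε * + 2
    E≡ = trans (cong +_ e′≡) (pos-* ε 2)
    halved : + c + + i′ * + 2 ≡ + c′ + + j′ * + 2 + k * + d′ + l * + e′ [mod n ]
    halved = scale⇐ {n} {2} {+ c + + i′ * + 2} {+ c′ + + j′ * + 2 + k * + d′ + l * + e′} (mod-modulus m≡2n
               (mod-trans (mod-reflexive (double (+ c) (+ i′))) (mod-trans (unfold {c} {c′} {i′} {j′} {d′} {e′} C) (mod-reflexive (factor (+ c′) (+ j′) k l (+ d′) (+ e′))))))
      where
      double : ∀ C I → (C + I * + 2) * + 2 ≡ + 2 * (C + I * + 2)
      double = solve-∀
      factor : ∀ C J k l D E → + 2 * (C + J * + 2) + k * (D * + 2) + l * (E * + 2) ≡ (C + J * + 2 + k * D + l * E) * + 2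
      factor = solve-∀
    drop : ∀ C I → C ≡ (C + I * + 2) + (- I) * + 2
    drop = solve-∀
    collect : ∀ C J k l δ ε → C + J * + 2 + k * (δ * + 2) + l * (ε * + 2) ≡ C + (J + k * δ + l * ε) * + 2
    collect = solve-∀

module Splitting where

  open import Defs
  open Congruence
  open Permutability
  open Lifting
  open ParameterGraph
  open GraphIso
  open import Data.Nat as ℕ using (ℕ; NonZero; _%_; _/_; _≤_; _<_; _≟_; _≤?_)
  open import Data.Nat.Properties using (≤-trans; <⇒≤; <⇒≱; <-≤-trans; +-monoˡ-<; *-monoˡ-≤; +-identityʳ)
  open import Data.Nat.DivMod using (m%n<n; m/n*n≡m; m<n*o⇒m/o<n; m≡m%n+[m/n]*n; [m+kn]%n≡m%n; m<n⇒m%n≡m; m*n/n≡m; +-distrib-/; m*n%n≡0; m<n⇒m/n≡0)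
  open import Data.Nat.Divisibility using (_∣_; _∣?_; divides; *-cancelʳ-∣; *-monoˡ-∣)
  open import Data.Fin using (toℕ; fromℕ<)
  open import Data.Fin.Properties using (toℕ-fromℕ<; fromℕ<-toℕ; toℕ<n; toℕ-injective)
  open import Data.Integer using (+_; _+_; _*_; _-_)
  open import Data.Integer.Properties using (pos-*)
  open import Data.Integer.Tactic.RingSolver using (solve-∀)
  open import Data.Product using (_,_; proj₁; proj₂)
  open import Data.Sum using (inj₁; inj₂)
  open import Data.Unit using (tt)
  open import Data.Empty using (⊥-elim)
  open import Relation.Binary.PropositionalEquality
  open import Relation.Nullary using (Dec; yes; no)
  open import Relation.Nullary.Decidable using (recompute)

  -- Parameters whose d divides 2 are compatible with every parameter:
  -- 2(i - j) is already a multiple of d.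
  compatible-small : ∀ {n δ} → δ ∣ 2 → ∀ i e j → Compatible n δ i e j
  compatible-small {n} {δ} (divides c 2≡cδ) i e j =
    compatible (+ c * (+ i - + j)) (+ 0) (mod-reflexive (begin
      + 2 * + i                                               ≡⟨ cong (_* + i) two≡ ⟩
      (+ c * + δ) * + i                                       ≡⟨ rearrange (+ c) (+ δ) (+ i) (+ j) (+ e) ⟩
      (+ c * + δ) * + j + (+ c * (+ i - + j)) * + δ + + 0 * + e ≡⟨ cong (λ z → z * + j + (+ c * (+ i - + j)) * + δ + + 0 * + e) two≡ ⟨
      + 2 * + j + (+ c * (+ i - + j)) * + δ + + 0 * + e         ∎))
    where
    open ≡-Reasoning
    two≡ : + 2 ≡ + c * + δ
    two≡ = trans (cong +_ 2≡cδ) (pos-* c δ)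
    rearrange : ∀ c δ i j e → (c * δ) * i ≡ (c * δ) * j + (c * (i - j)) * δ + + 0 * e
    rearrange = solve-∀

  compatible-small′ : ∀ {n δ} → δ ∣ 2 → ∀ d i j → Compatible n d i δ j
  compatible-small′ {n} {δ} small d i j = compatible-sym (compatible-small small j d i)

  -- The δ parameters
  -- (δ, i), i < δ, are compatible with everything, so they form a K_δ joined to
  -- the rest:  ParamGraph t n ≅ ParamGraph t′ n + K_δ.
  module SplitSmallDivisor (t t′ n δ : ℕ) (δ∣2 : δ ∣ 2) (δ∣n : δ ∣ n) (t≤δ : t ≤ δ) (δ<t′ : δ < t′)
                           (others : ∀ d → d ∣ n → t ≤ d → d ≢ δ → t′ ≤ d) where

    private
      split : (u : Param t n) → Dec (d u ≡ δ) → V (ParamGraph t′ n ⊕ K δ)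
      split (param d i d∣n t≤d i<d) (yes d≡δ) = inj₂ (fromℕ< (subst (i <_) d≡δ i<d))
      split (param d i d∣n t≤d i<d) (no d≢δ)  = inj₁ (param d i d∣n (others d d∣n t≤d d≢δ) i<d)

      to′ : Param t n → V (ParamGraph t′ n ⊕ K δ)
      to′ u = split u (d u ≟ δ)

      from′ : V (ParamGraph t′ n ⊕ K δ) → Param t n
      from′ (inj₁ (param d i d∣n t′≤d i<d)) = param d i d∣n (≤-trans (≤-trans t≤δ (<⇒≤ δ<t′)) t′≤d) i<d
      from′ (inj₂ c) = param δ (toℕ c) δ∣n t≤δ (toℕ<n c)

      from-to′ : ∀ u → from′ (to′ u) ≡ u
      from-to′ u with d u ≟ δ
      ... | yes d≡δ = param-ext (sym d≡δ) (toℕ-fromℕ< _)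
      ... | no _    = refl

      to-from′ : ∀ x → to′ (from′ x) ≡ x
      to-from′ (inj₁ (param d i d∣n t′≤d i<d)) with d ≟ δ
      ... | yes d≡δ = ⊥-elim (<⇒≱ δ<t′ (subst (t′ ≤_) d≡δ (recompute (t′ ≤? d) t′≤d)))
      ... | no _    = refl
      to-from′ (inj₂ c) with δ ≟ δ
      ... | yes _ = cong inj₂ (fromℕ<-toℕ c _)
      ... | no δ≢δ = ⊥-elim (δ≢δ refl)

      fromℕ<-injective : ∀ {k x y} .{x<k : x < k} .{y<k : y < k} → fromℕ< x<k ≡ fromℕ< y<k → x ≡ y
      fromℕ<-injective eq = trans (sym (toℕ-fromℕ< _)) (trans (cong toℕ eq) (toℕ-fromℕ< _))

      distinct-d : ∀ {u v : Param t n} → d u ≢ d v → u ≢ v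
      distinct-d d≢ refl = d≢ refl

      preserve : ∀ u v → Adj (ParamGraph t n) u v → Adj (ParamGraph t′ n ⊕ K δ) (to′ u) (to′ v)
      preserve u v (u≢v , c) with d u ≟ δ | d v ≟ δ
      ... | yes du≡δ | yes dv≡δ = λ eq → u≢v (param-ext (trans du≡δ (sym dv≡δ)) (fromℕ<-injective eq))
      ... | yes _    | no _     = tt
      ... | no _     | yes _    = tt
      ... | no _     | no _     = (λ eq → u≢v (param-ext (cong d eq) (cong i eq))) , c

      reflect : ∀ u v → Adj (ParamGraph t′ n ⊕ K δ) (to′ u) (to′ v) → Adj (ParamGraph t n) u v
      reflect u v a with d u ≟ δ | d v ≟ δ
      ... | yes du≡δ | yes dv≡δ =
            (λ eq → a (toℕ-injective (trans (toℕ-fromℕ< _) (trans (cong i eq) (sym (toℕ-fromℕ< _)))))) ,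
            subst (λ x → Compatible n x (i u) (d v) (i v)) (sym du≡δ) (compatible-small δ∣2 (i u) (d v) (i v))
      ... | yes du≡δ | no dv≢δ =
            distinct-d (λ e → dv≢δ (trans (sym e) du≡δ)) ,
            subst (λ x → Compatible n x (i u) (d v) (i v)) (sym du≡δ) (compatible-small δ∣2 (i u) (d v) (i v))
      ... | no du≢δ | yes dv≡δ =
            distinct-d (λ e → du≢δ (trans e dv≡δ)) ,
            subst (λ x → Compatible n (d u) (i u) x (i v)) (sym dv≡δ) (compatible-small′ δ∣2 (d u) (i u) (i v))
      ... | no _ | no _ = (λ eq → proj₁ a (param-ext (cong d eq) (cong i eq))) , proj₂ a

    iso : GraphIso (ParamGraph t n) (ParamGraph t′ n ⊕ K δ)
    iso = record { to = to′ ; from = from′ ; from-to = from-to′ ; to-from = to-from′ ; adj⇒ = preserve ; adj⇐ = reflect }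

  -- Let m = n p and suppose every admissible d for m
  -- is a multiple of p.  Writing d = d′p and i = c + i′p with c < p, a parameter
  -- (d, i) for m corresponds to the residue c together with a parameter
  -- (d′, i′) for n.  Lifted parameters with equal residues are compatible iff
  -- their reductions are (Lift); if moreover compatibility forces equal
  -- residues, then ParamGraph t m ≅ p · ParamGraph t′ n.
  module SplitCopies (p n m t t′ : ℕ) {{_ : NonZero p}} (m≡np : m ≡ n ℕ.* p)
      (p∣d : ∀ d → d ∣ m → t ≤ d → p ∣ d)
      (threshold⇒ : ∀ d′ → t ≤ d′ ℕ.* p → t′ ≤ d′)
      (threshold⇐ : ∀ d′ → t′ ≤ d′ → t ≤ d′ ℕ.* p)
      (same-residue : ∀ {c c′ i′ j′ d′ e′} → d′ ∣ n → t′ ≤ d′ → e′ ∣ n → t′ ≤ e′ →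
         Compatible m (d′ ℕ.* p) (c ℕ.+ i′ ℕ.* p) (e′ ℕ.* p) (c′ ℕ.+ j′ ℕ.* p) → + c ≡ + c′ [mod p ]) where

    open Lift p n m m≡np using (lift; descend)

    private
      d/p*p : ∀ {d} → .(d ∣ m) → .(t ≤ d) → d / p ℕ.* p ≡ d
      d/p*p {d} d∣m t≤d = m/n*n≡m (recompute (p ∣? d) (p∣d d d∣m t≤d))

      i%p+i/p*p : ∀ i → i % p ℕ.+ i / p ℕ.* p ≡ i
      i%p+i/p*p i = sym (m≡m%n+[m/n]*n i p)

      d/p∣n : ∀ {d} → .(d ∣ m) → .(t ≤ d) → d / p ∣ n
      d/p∣n {d} d∣m t≤d = *-cancelʳ-∣ p (subst₂ _∣_ (sym (d/p*p d∣m t≤d)) m≡np (recompute (d ∣? m) d∣m))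

      t′≤d/p : ∀ {d} → .(d ∣ m) → .(t ≤ d) → t′ ≤ d / p
      t′≤d/p {d} d∣m t≤d = threshold⇒ (d / p) (subst (t ≤_) (sym (d/p*p d∣m t≤d)) (recompute (t ≤? d) t≤d))

      to′ : Param t m → V (copies p (ParamGraph t′ n))
      to′ (param d i d∣m t≤d i<d) = fromℕ< (m%n<n i p) ,
        param (d / p) (i / p) (d/p∣n d∣m t≤d) (t′≤d/p d∣m t≤d) (m<n*o⇒m/o<n (subst (i <_) (sym (d/p*p d∣m t≤d)) i<d))

      from′ : V (copies p (ParamGraph t′ n)) → Param t m
      from′ (c , param d′ i′ d′∣n t′≤d′ i′<d′) =
        param (d′ ℕ.* p) (toℕ c ℕ.+ i′ ℕ.* p) (subst (d′ ℕ.* p ∣_) (sym m≡np) (*-monoˡ-∣ p d′∣n)) (threshold⇐ d′ t′≤d′)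
              (<-≤-trans (+-monoˡ-< (i′ ℕ.* p) (toℕ<n c)) (*-monoˡ-≤ p i′<d′))

      from-to′ : ∀ u → from′ (to′ u) ≡ u
      from-to′ (param d i d∣m t≤d i<d) = param-ext (d/p*p d∣m t≤d) (trans (cong (ℕ._+ i / p ℕ.* p) (toℕ-fromℕ< _)) (i%p+i/p*p i))

      residue-of : ∀ c i′ → c < p → (c ℕ.+ i′ ℕ.* p) % p ≡ c
      residue-of c i′ c<p = trans ([m+kn]%n≡m%n c i′ p) (m<n⇒m%n≡m c<p)

      quotient-of : ∀ c i′ → c < p → (c ℕ.+ i′ ℕ.* p) / p ≡ i′
      quotient-of c i′ c<p =
        trans (+-distrib-/ c (i′ ℕ.* p) (subst (_< p) (sym (trans (cong₂ ℕ._+_ (m<n⇒m%n≡m c<p) (m*n%n≡0 i′ p)) (+-identityʳ c))) c<p))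
              (cong₂ ℕ._+_ (m<n⇒m/n≡0 c<p) (m*n/n≡m i′ p))

      to-from′ : ∀ x → to′ (from′ x) ≡ x
      to-from′ (c , param d′ i′ _ _ _) =
        cong₂ _,_ (toℕ-injective (trans (toℕ-fromℕ< _) (residue-of (toℕ c) i′ (toℕ<n c))))
                  (param-ext (m*n/n≡m d′ p) (quotient-of (toℕ c) i′ (toℕ<n c)))

      cast : ∀ {M d i e j d₂ i₂ e₂ j₂} → d ≡ d₂ → i ≡ i₂ → e ≡ e₂ → j ≡ j₂ → Compatible M d i e j → Compatible M d₂ i₂ e₂ j₂
      cast refl refl refl refl c = c

      preserve : ∀ u v → Adj (ParamGraph t m) u v → Adj (copies p (ParamGraph t′ n)) (to′ u) (to′ v)
      preserve u@(param d i d∣m t≤d i<d) v@(param e j e∣m t≤e j<e) (u≢v , c) =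
        toℕ-injective (trans (toℕ-fromℕ< _) (trans residues (sym (toℕ-fromℕ< _)))) ,
        (λ eq → u≢v (param-ext (trans (sym (d/p*p d∣m t≤d)) (trans (cong (λ w → Param.d w ℕ.* p) eq) (d/p*p e∣m t≤e)))
                               (trans (sym (i%p+i/p*p i)) (trans (cong₂ (λ a b → a ℕ.+ b ℕ.* p) residues (cong Param.i eq)) (i%p+i/p*p j))))) ,
        lifted
        where
        c′ : Compatible m (d / p ℕ.* p) (i % p ℕ.+ i / p ℕ.* p) (e / p ℕ.* p) (j % p ℕ.+ j / p ℕ.* p)
        c′ = cast (sym (d/p*p d∣m t≤d)) (sym (i%p+i/p*p i)) (sym (d/p*p e∣m t≤e)) (sym (i%p+i/p*p j)) c
        residues : i % p ≡ j % p
        residues = mod-residue (m%n<n i p) (m%n<n j p)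
          (same-residue {i % p} {j % p} {i / p} {j / p} {d / p} {e / p} (recompute (d / p ∣? n) (d/p∣n d∣m t≤d)) (recompute (t′ ≤? d / p) (t′≤d/p d∣m t≤d))
                        (recompute (e / p ∣? n) (d/p∣n e∣m t≤e)) (recompute (t′ ≤? e / p) (t′≤d/p e∣m t≤e)) c′)
        lifted : Compatible n (d / p) (i / p) (e / p) (j / p)
        lifted = descend (i % p) (i / p) (j / p) (d / p) (e / p)
                   (subst (λ r → Compatible m (d / p ℕ.* p) (i % p ℕ.+ i / p ℕ.* p) (e / p ℕ.* p) (r ℕ.+ j / p ℕ.* p)) (sym residues) c′)

      reflect : ∀ u v → Adj (copies p (ParamGraph t′ n)) (to′ u) (to′ v) → Adj (ParamGraph t m) u v
      reflect u@(param d i d∣m t≤d i<d) v@(param e j e∣m t≤e j<e) (same-copy , u′≢v′ , c′) =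
        (λ eq → u′≢v′ (cong (λ w → proj₂ (to′ w)) eq)) ,
        cast (d/p*p d∣m t≤d) (i%p+i/p*p i) (d/p*p e∣m t≤e) (trans (cong (ℕ._+ j / p ℕ.* p) residues) (i%p+i/p*p j))
             (lift (i % p) (i / p) (j / p) (d / p) (e / p) c′)
        where
        residues : i % p ≡ j % p
        residues = trans (sym (toℕ-fromℕ< _)) (trans (cong toℕ same-copy) (toℕ-fromℕ< _))

    iso : GraphIso (ParamGraph t m) (copies p (ParamGraph t′ n))
    iso = record { to = to′ ; from = from′ ; from-to = from-to′ ; to-from = to-from′ ; adj⇒ = preserve ; adj⇐ = reflect }

module PrimePowers where

  open import Defs
  open Congruence
  open ParameterGraph
  open Lifting
  open Splitting
  open GraphIso
  open import Data.Nat as ℕ using (ℕ; zero; suc; NonZero; _≤_; _^_; _*_; z≤n; s≤s)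
  open import Data.Nat.Properties using (≤-refl; ≤-trans; <⇒≱; m≤m+n; *-comm; *-identityʳ)
  open import Data.Nat.Divisibility using (_∣_; _∣?_; divides; ∣⇒≤; ∣1⇒≡1)
  open import Data.Nat.Coprimality using (Coprime; coprime-divisor)
  open import Data.Nat.Primality using (Prime; prime⇒irreducible; prime⇒nonZero; prime[2])
  open import Data.Product using (_,_)
  open import Data.Sum using (inj₁; inj₂)
  open import Data.Empty using (⊥-elim)
  open import Relation.Binary.PropositionalEquality
  open import Relation.Nullary using (¬_; yes; no)

  coprime-to-prime : ∀ {p d} → Prime p → ¬ p ∣ d → Coprime d p
  coprime-to-prime p-prime p∤d (c∣d , c∣p) with prime⇒irreducible p-prime c∣p
  ... | inj₁ c≡1 = c≡1
  ... | inj₂ refl = ⊥-elim (p∤d c∣d)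

  prime-power-divisor : ∀ {p} → Prime p → ∀ β d → d ∣ p ^ β → d ≢ 1 → p ∣ d
  prime-power-divisor {p} p-prime β d d∣p^β d≢1 with p ∣? d
  ... | yes p∣d = p∣d
  ... | no p∤d = ⊥-elim (d≢1 (∣1⇒≡1 (peel β d∣p^β)))
    where peel : ∀ β → d ∣ p ^ β → d ∣ 1
          peel zero    d∣1 = d∣1
          peel (suc β) d∣p^β = peel β (coprime-divisor (coprime-to-prime p-prime p∤d) d∣p^β)

  pow-suc : ∀ p a → p ^ suc a ≡ p ^ a * p
  pow-suc p a = *-comm p (p ^ a)

  private
    3≤⇒≢1 : ∀ {d} → 3 ≤ d → d ≢ 1
    3≤⇒≢1 (s≤s (s≤s _)) ()

    2≤⇒≢1 : ∀ {d} → 2 ≤ d → d ≢ 1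
    2≤⇒≢1 (s≤s (s≤s _)) ()

    threshold-two⇒ : ∀ d′ → 3 ≤ d′ * 2 → 2 ≤ d′
    threshold-two⇒ (suc zero) (s≤s (s≤s ()))
    threshold-two⇒ (suc (suc d′)) _ = s≤s (s≤s z≤n)

    threshold-two⇐ : ∀ d′ → 2 ≤ d′ → 3 ≤ d′ * 2
    threshold-two⇐ (suc zero) (s≤s ())
    threshold-two⇐ (suc (suc d′)) _ = s≤s (s≤s (s≤s z≤n))

    threshold-odd⇒ : ∀ p d′ → 3 ≤ d′ * p → 1 ≤ d′
    threshold-odd⇒ p (suc d′) _ = s≤s z≤n

    threshold-odd⇐ : ∀ p → 3 ≤ p → ∀ d′ → 1 ≤ d′ → 3 ≤ d′ * p
    threshold-odd⇐ p 3≤p (suc d′) _ = ≤-trans 3≤p (m≤m+n p (d′ * p))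

    two-is-smallest : ∀ n d → d ∣ n → 2 ≤ d → d ≢ 2 → 3 ≤ d
    two-is-smallest n (suc zero) _ (s≤s ()) _
    two-is-smallest n (suc (suc zero)) _ _ d≢2 = ⊥-elim (d≢2 refl)
    two-is-smallest n (suc (suc (suc d))) _ _ _ = s≤s (s≤s (s≤s z≤n))

  two-power-step : ∀ a → GraphIso (ParamGraph 3 (2 ^ suc (suc a))) (copies 2 (ParamGraph 3 (2 ^ suc a) ⊕ K 2))
  two-power-step a =
    SplitCopies.iso 2 n (2 ^ suc (suc a)) 3 2 (pow-suc 2 (suc a)) (λ d d∣m 3≤d → even d d∣m 3≤d)
      threshold-two⇒ threshold-two⇐
      (λ {c} {c′} {i′} {j′} {d′} {e′} d′∣n 2≤d′ e′∣n 2≤e′ →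
         same-residue-two n _ (pow-suc 2 (suc a)) 2∣n {c} {c′} {i′} {j′} {d′} {e′} (even′ d′∣n 2≤d′) (even′ e′∣n 2≤e′))
    ⟫ copies-cong (SplitSmallDivisor.iso 2 3 n 2 (divides 1 refl) 2∣n ≤-refl (s≤s (s≤s (s≤s z≤n))) (two-is-smallest n))
    where
    n : ℕ
    n = 2 ^ suc a
    2∣n : 2 ∣ n
    2∣n = divides (2 ^ a) (pow-suc 2 a)
    even : ∀ d → d ∣ 2 ^ suc (suc a) → 3 ≤ d → 2 ∣ d
    even d d∣m 3≤d = prime-power-divisor prime[2] (suc (suc a)) d d∣m (3≤⇒≢1 3≤d)
    even′ : ∀ {d} → d ∣ n → 2 ≤ d → 2 ∣ d
    even′ {d} d∣n 2≤d = prime-power-divisor prime[2] (suc a) d d∣n (2≤⇒≢1 2≤d)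

  odd-power-step : ∀ p (p-prime : Prime p) → 3 ≤ p → ∀ a →
                   GraphIso (ParamGraph 3 (p ^ suc a)) (copies p (ParamGraph 3 (p ^ a) ⊕ K 1))
  odd-power-step p p-prime 3≤p a =
    SplitCopies.iso p n (p ^ suc a) 3 1 {{p≢0}} (pow-suc p a) p∣d (threshold-odd⇒ p) (threshold-odd⇐ p 3≤p)
      (λ {c} {c′} {i′} {j′} {d′} {e′} _ _ _ _ →
         Lift.same-residue-odd p n (p ^ suc a) {{p≢0}} (pow-suc p a) p-prime 3≤p {c} {c′} {i′} {j′} {d′} {e′})
    ⟫ copies-cong (SplitSmallDivisor.iso 1 3 n 1 (divides 2 refl) (divides n (sym (*-identityʳ n))) ≤-refl
                     (s≤s (s≤s z≤n)) others)
    where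
    p≢0 : NonZero p
    p≢0 = prime⇒nonZero p-prime
    n : ℕ
    n = p ^ a
    p∣d : ∀ d → d ∣ p ^ suc a → 3 ≤ d → p ∣ d
    p∣d d d∣m 3≤d = prime-power-divisor p-prime (suc a) d d∣m (3≤⇒≢1 3≤d)
    others : ∀ d → d ∣ n → 1 ≤ d → d ≢ 1 → 3 ≤ d
    others d d∣n 1≤d d≢1 = ≤-trans 3≤p (∣⇒≤ {{ℕ.>-nonZero 1≤d}} (prime-power-divisor p-prime a d d∣n d≢1))

  -- The parameters (1,0), (2,0), (2,1) for D₂ with threshold 1 form a triangle.
  params-2 : GraphIso (ParamGraph 1 2) (K 3)
  params-2 =
    SplitSmallDivisor.iso 1 2 2 1 (divides 2 refl) (divides 2 refl) ≤-refl (s≤s (s≤s z≤n)) above-1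
    ⟫ ⊕-cong (SplitSmallDivisor.iso 2 3 2 2 (divides 1 refl) (divides 1 refl) ≤-refl (s≤s (s≤s (s≤s z≤n))) (two-is-smallest 2)
              ⟫ empty-⊕ (no-params (s≤s (s≤s (s≤s z≤n)))))
             iso-refl
    ⟫ K-join 2 1
    where
    above-1 : ∀ d → d ∣ 2 → 1 ≤ d → d ≢ 1 → 2 ≤ d
    above-1 (suc zero) _ _ d≢1 = ⊥-elim (d≢1 refl)
    above-1 (suc (suc d)) _ _ _ = s≤s (s≤s z≤n)

  twice-prime : ∀ p (p-prime : Prime p) → 3 ≤ p → GraphIso (ParamGraph 3 (2 * p)) (copies p (K 3))
  twice-prime p p-prime 3≤p =
    SplitCopies.iso p 2 (2 * p) 3 1 {{p≢0}} refl p∣d (threshold-odd⇒ p) (threshold-odd⇐ p 3≤p)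
      (λ {c} {c′} {i′} {j′} {d′} {e′} _ _ _ _ →
         Lift.same-residue-odd p 2 (2 * p) {{p≢0}} refl p-prime 3≤p {c} {c′} {i′} {j′} {d′} {e′})
    ⟫ copies-cong params-2
    where
    p≢0 : NonZero p
    p≢0 = prime⇒nonZero p-prime
    -- A divisor d ≥ 3 of 2p coprime to p would divide 2.
    p∣d : ∀ d → d ∣ 2 * p → 3 ≤ d → p ∣ d
    p∣d d d∣2p 3≤d with p ∣? d
    ... | yes p∣d = p∣d
    ... | no p∤d = ⊥-elim (<⇒≱ (s≤s (s≤s (s≤s z≤n))) (≤-trans 3≤d (∣⇒≤ (coprime-divisor (coprime-to-prime p-prime p∤d) (subst (d ∣_) (*-comm 2 p) d∣2p)))))

module TwoPrimes where

  open import Defs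
  open Congruence
  open Permutability
  open ParameterGraph
  open Lifting
  open PrimePowers using (coprime-to-prime)
  open GraphIso
  open import Data.Nat as ℕ using (ℕ; NonZero; _%_; _≤_; _<_; _*_; _<?_; _≤?_; z≤n; s≤s)
  open import Data.Nat.Properties using (≤-trans; <-≤-trans; <⇒≤; <⇒≢; *-comm; +-identityʳ; m<m*n; m*n≢0)
  open import Data.Nat.DivMod using (m%n<n; m<n⇒m%n≡m; m%n%n≡m%n)
  open import Data.Nat.Divisibility using (_∣_; _∣?_; divides; ∣-refl; *-cancelʳ-∣)
  open import Data.Nat.Coprimality using (Coprime; coprime-divisor; coprime-Bézout; prime⇒coprime)
  import Data.Nat.Coprimality as Coprimality
  open import Data.Nat.GCD using (module Bézout)
  open import Data.Nat.Primality using (Prime; prime⇒irreducible; prime⇒nonZero)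
  open import Data.Integer using (ℤ; +_; _+_; _-_; -_) renaming (_*_ to _×_)
  open import Data.Integer.Properties using (pos-+; pos-*)
  open import Data.Integer.DivMod using (n%ℕd<d)
  open import Data.Integer.Tactic.RingSolver using (solve-∀)
  open import Data.Fin using (Fin; toℕ; fromℕ<)
  open import Data.Fin.Properties using (toℕ-fromℕ<; fromℕ<-toℕ; fromℕ<-cong; toℕ<n; toℕ-injective)
  open import Data.Product using (_,_; proj₁; proj₂) renaming (_×_ to _∧_)
  open import Data.Sum using (_⊎_; inj₁; inj₂)
  open import Data.Empty using (⊥-elim)
  open import Relation.Binary.PropositionalEquality
  open import Relation.Nullary using (yes; no)
  open import Relation.Nullary.Decidable using (recompute)

  record Bezout (p q : ℕ) : Set where
    constructor bezout
    field
      α β      : ℤ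
      identity : α × + q + β × + p ≡ + 1

  private
    as-ℤ : ∀ a b c d → 1 ℕ.+ a * b ≡ c * d → + 1 + + a × + b ≡ + c × + d
    as-ℤ a b c d eq = trans (cong (_+_ (+ 1)) (sym (pos-* a b))) (trans (sym (pos-+ 1 (a * b))) (trans (cong +_ eq) (pos-* c d)))

  bezout-of : ∀ {p q} → Coprime p q → Bezout p q
  bezout-of {p} {q} c with coprime-Bézout c
  ... | Bézout.+- x y eq = bezout (- + y) (+ x)
    (trans (cong (λ z → (- + y) × + q + z) (sym (as-ℤ y q x p eq))) (cancel (+ y) (+ q)))
    where cancel : ∀ y q → (- y) × q + (+ 1 + y × q) ≡ + 1
          cancel = solve-∀
  ... | Bézout.-+ x y eq = bezout (+ y) (- + x)
    (trans (cong (λ z → z + (- + x) × + p) (sym (as-ℤ x p y q eq))) (cancel (+ x) (+ p)))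
    where cancel : ∀ x p → (+ 1 + x × p) + (- x) × p ≡ + 1
          cancel = solve-∀

  compatible⇒mod : ∀ {M r d i e j} → r ∣ M → r ∣ d → r ∣ e → Compatible M d i e j → + 2 × + i ≡ + 2 × + j [mod r ]
  compatible⇒mod {r = r} {j = j} r∣M (divides δ refl) (divides ε refl) (compatible k l congruence) =
    mod-trans (mod-divisor r∣M congruence)
      (witness (k × + δ + l × + ε) (trans (cong₂ (λ u v → + 2 × + j + k × u + l × v) (pos-* δ r) (pos-* ε r))
                                        (collect (+ 2 × + j) k l (+ δ) (+ ε) (+ r))))
    where collect : ∀ J k l D E R → J + k × (D × R) + l × (E × R) ≡ J + (k × D + l × E) × R
          collect = solve-∀

  mod⇒compatible : ∀ {M d i e j} → + i ≡ + j [mod d ] → Compatible M d i e j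
  mod⇒compatible {M} {d} {i} {e} {j} (witness s i≡) =
    compatible (+ 2 × s) (+ 0) (mod-reflexive (trans (cong (+ 2 ×_) i≡) (expand (+ j) s (+ d) (+ e))))
    where expand : ∀ J S D E → + 2 × (J + S × D) ≡ + 2 × J + (+ 2 × S) × D + + 0 × E
          expand = solve-∀

  coprime⇒compatible : ∀ {M d e} → Bezout d e → ∀ i j → Compatible M d i e j
  coprime⇒compatible {M} {d} {e} (bezout α β identity) i j =
    compatible (X × β) (X × α) (mod-reflexive (begin
      + 2 × + i                                     ≡⟨ split (+ i) (+ j) ⟩
      + 2 × + j + X × + 1                           ≡⟨ cong (λ z → + 2 × + j + X × z) identity ⟨
      + 2 × + j + X × (α × + e + β × + d)           ≡⟨ distribute (+ 2 × + j) X α β (+ d) (+ e) ⟩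
      + 2 × + j + (X × β) × + d + (X × α) × + e     ∎))
    where
    open ≡-Reasoning
    X : ℤ
    X = + 2 × + i - + 2 × + j
    split : ∀ I J → + 2 × I ≡ + 2 × J + (+ 2 × I - + 2 × J) × + 1
    split = solve-∀
    distribute : ∀ J X α β D E → J + X × (α × E + β × D) ≡ J + (X × β) × D + (X × α) × E
    distribute = solve-∀

  module CRT (p q : ℕ) {{_ : NonZero p}} {{_ : NonZero q}} (B : Bezout p q) where
    open Bezout B

    instance
      pq≢0 : NonZero (p * q)
      pq≢0 = m*n≢0 p q

    -- The residue modulo pq of crtℤ a b = a α q + b β p, which is ≡ a (mod p) and ≡ b (mod q).
    crtℤ : ℕ → ℕ → ℤ
    crtℤ a b = + a × (α × + q) + + b × (β × + p)

    crt : ℕ → ℕ → ℕ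
    crt a b = residue (p * q) (crtℤ a b)

    crt< : ∀ a b → crt a b < p * q
    crt< a b = n%ℕd<d (crtℤ a b) (p * q)

    private
      unit : ∀ a Y → a × + 1 + Y ≡ a + Y
      unit = solve-∀

    crt-p : ∀ a b → + crt a b ≡ + a [mod p ]
    crt-p a b = mod-trans (mod-divisor (divides q (*-comm p q)) (residue-mod (p * q) (crtℤ a b)))
      (witness (+ b × β - + a × β) (begin
        + a × (α × + q) + + b × (β × + p)                       ≡⟨ regroup (+ a) (+ b) α β (+ p) (+ q) ⟩
        + a × (α × + q + β × + p) + (+ b × β - + a × β) × + p   ≡⟨ cong (λ z → + a × z + (+ b × β - + a × β) × + p) identity ⟩
        + a × + 1 + (+ b × β - + a × β) × + p                   ≡⟨ unit (+ a) _ ⟩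
        + a + (+ b × β - + a × β) × + p                         ∎))
      where
      open ≡-Reasoning
      regroup : ∀ a b α β P Q → a × (α × Q) + b × (β × P) ≡ a × (α × Q + β × P) + (b × β - a × β) × P
      regroup = solve-∀

    crt-q : ∀ a b → + crt a b ≡ + b [mod q ]
    crt-q a b = mod-trans (mod-divisor (divides p refl) (residue-mod (p * q) (crtℤ a b)))
      (witness (+ a × α - + b × α) (begin
        + a × (α × + q) + + b × (β × + p)                       ≡⟨ regroup (+ a) (+ b) α β (+ p) (+ q) ⟩
        + b × (α × + q + β × + p) + (+ a × α - + b × α) × + q   ≡⟨ cong (λ z → + b × z + (+ a × α - + b × α) × + q) identity ⟩
        + b × + 1 + (+ a × α - + b × α) × + q                   ≡⟨ unit (+ b) _ ⟩
        + b + (+ a × α - + b × α) × + q                         ∎))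
      where
      open ≡-Reasoning
      regroup : ∀ a b α β P Q → a × (α × Q) + b × (β × P) ≡ b × (α × Q + β × P) + (a × α - b × α) × Q
      regroup = solve-∀

    crt-unique : ∀ {x y} → x < p * q → y < p * q → + x ≡ + y [mod p ] → + x ≡ + y [mod q ] → x ≡ y
    crt-unique {x} {y} x< y< (witness s x≡p) (witness t x≡q) =
      mod-residue x< y< (witness (s × α + t × β) (trans (sym (restore (+ x) (+ y))) (cong (_+_ (+ y)) (begin
        D                                           ≡⟨ unit′ D ⟩
        D × + 1                                     ≡⟨ cong (D ×_) identity ⟨
        D × (α × + q + β × + p)                     ≡⟨ split D α β (+ p) (+ q) ⟩
        D × (α × + q) + D × (β × + p)               ≡⟨ cong₂ (λ u v → u × (α × + q) + v × (β × + p)) (subtract {s × + p} x≡p) (subtract {t × + q} x≡q) ⟩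
        (s × + p) × (α × + q) + (t × + q) × (β × + p) ≡⟨ collect s t α β (+ p) (+ q) ⟩
        (s × α + t × β) × (+ p × + q)               ≡⟨ cong ((s × α + t × β) ×_) (pos-* p q) ⟨
        (s × α + t × β) × + (p * q)                 ∎))))
      where
      open ≡-Reasoning
      D : ℤ
      D = + x - + y
      restore : ∀ x y → y + (x - y) ≡ x
      restore = solve-∀
      unit′ : ∀ z → z ≡ z × + 1
      unit′ = solve-∀
      split : ∀ z α β P Q → z × (α × Q + β × P) ≡ z × (α × Q) + z × (β × P)
      split = solve-∀
      collect : ∀ s t α β P Q → (s × P) × (α × Q) + (t × Q) × (β × P) ≡ (s × α + t × β) × (P × Q)
      collect = solve-∀
      subtract : ∀ {c} → + x ≡ + y + c → D ≡ c
      subtract {c} eq = trans (cong (_- + y) eq) (cancel (+ y) c)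
        where cancel : ∀ y c → (y + c) - y ≡ c
              cancel = solve-∀

  -- Γ_N(D_pq) for primes 2 < p < q, on the level of parameters.  The
  -- admissible d are p, q and pq; a parameter (d, i) is sent to u_i, v_i or
  -- w_(i mod p, i mod q) respectively.
  module ProductOfTwoPrimes (p q : ℕ) (p-prime : Prime p) (q-prime : Prime q) (3≤p : 3 ≤ p) (p<q : p < q) where

    instance
      p≢0 : NonZero p
      p≢0 = prime⇒nonZero p-prime
      q≢0 : NonZero q
      q≢0 = prime⇒nonZero q-prime

    B : Bezout p q
    B = bezout-of (Coprimality.sym (prime⇒coprime q-prime p<q))

    open CRT p q B

    private
      3≤q : 3 ≤ q
      3≤q = ≤-trans 3≤p (<⇒≤ p<q)
      p∣pq : p ∣ p * q
      p∣pq = divides q (*-comm p q)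
      q∣pq : q ∣ p * q
      q∣pq = divides p refl
      p<pq : p < p * q
      p<pq = m<m*n p q (<-≤-trans (s≤s (s≤s z≤n)) 3≤q)
      q<pq : q < p * q
      q<pq = subst (q <_) (*-comm q p) (m<m*n q p (<-≤-trans (s≤s (s≤s z≤n)) 3≤p))
      3≤pq : 3 ≤ p * q
      3≤pq = ≤-trans 3≤p (<⇒≤ p<pq)

    divisors : ∀ d → d ∣ p * q → d ≡ 1 ⊎ d ≡ p ⊎ d ≡ q ⊎ d ≡ p * q
    divisors d d∣pq with p ∣? d
    ... | no p∤d with prime⇒irreducible q-prime (coprime-divisor (coprime-to-prime p-prime p∤d) d∣pq)
    ...   | inj₁ d≡1 = inj₁ d≡1
    ...   | inj₂ d≡q = inj₂ (inj₂ (inj₁ d≡q))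
    divisors d d∣pq | yes (divides d′ refl) with prime⇒irreducible q-prime {d′} (*-cancelʳ-∣ p (subst (d′ * p ∣_) (*-comm p q) d∣pq))
    ... | inj₁ refl = inj₂ (inj₁ (+-identityʳ p))
    ... | inj₂ refl = inj₂ (inj₂ (inj₂ (*-comm q p)))

    data Kind (u : Param 3 (p * q)) : Set where
      over-p  : d u ≡ p → Kind u
      over-q  : d u ≡ q → Kind u
      over-pq : d u ≡ p * q → Kind u

    kind : (u : Param 3 (p * q)) → Kind u
    kind (param d i d∣pq 3≤d i<d) with divisors d (recompute (d ∣? p * q) d∣pq)
    ... | inj₁ refl with recompute (3 ≤? 1) 3≤d
    ...   | s≤s ()
    kind _ | inj₂ (inj₁ d≡p)         = over-p d≡p
    kind _ | inj₂ (inj₂ (inj₁ d≡q))  = over-q d≡q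
    kind _ | inj₂ (inj₂ (inj₂ d≡pq)) = over-pq d≡pq

    private
      below : ∀ {r} (u : Param 3 (p * q)) → d u ≡ r → i u < r
      below (param d i _ _ i<d) refl = recompute (i <? d) i<d

      fromℕ<-≡ : ∀ {k x y} .{x<k : x < k} .{y<k : y < k} → x ≡ y → fromℕ< x<k ≡ fromℕ< y<k
      fromℕ<-≡ {x = x} refl = fromℕ<-cong x x refl _ _

      fromℕ<-injective : ∀ {k x y} .{x<k : x < k} .{y<k : y < k} → fromℕ< x<k ≡ fromℕ< y<k → x ≡ y
      fromℕ<-injective eq = trans (sym (toℕ-fromℕ< _)) (trans (cong toℕ eq) (toℕ-fromℕ< _))

      reduce : ∀ x r .{{_ : NonZero r}} → + (x % r) ≡ + x [mod r ]
      reduce x r = %⇒mod (m%n%n≡m%n x r)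

    to-tri : (u : Param 3 (p * q)) → Kind u → TriVertex p q
    to-tri u (over-p d≡p)   = inj₁ (fromℕ< (below u d≡p))
    to-tri u (over-q d≡q)   = inj₂ (inj₁ (fromℕ< (below u d≡q)))
    to-tri u (over-pq _)    = inj₂ (inj₂ (fromℕ< (m%n<n (i u) p) , fromℕ< (m%n<n (i u) q)))

    to′ : Param 3 (p * q) → TriVertex p q
    to′ u = to-tri u (kind u)

    from′ : TriVertex p q → Param 3 (p * q)
    from′ (inj₁ a)             = param p (toℕ a) p∣pq 3≤p (toℕ<n a)
    from′ (inj₂ (inj₁ b))      = param q (toℕ b) q∣pq 3≤q (toℕ<n b)
    from′ (inj₂ (inj₂ (a , b))) = param (p * q) (crt (toℕ a) (toℕ b)) ∣-refl 3≤pq (crt< (toℕ a) (toℕ b))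

    from-to′ : ∀ u → from′ (to′ u) ≡ u
    from-to′ u with kind u
    ... | over-p d≡p = param-ext (sym d≡p) (toℕ-fromℕ< _)
    ... | over-q d≡q = param-ext (sym d≡q) (toℕ-fromℕ< _)
    ... | over-pq d≡pq = param-ext (sym d≡pq) (crt-unique (crt< a b) (below u d≡pq)
          (mod-trans (crt-p a b) (subst (λ z → + z ≡ + i u [mod p ]) (sym (toℕ-fromℕ< _)) (reduce (i u) p)))
          (mod-trans (crt-q a b) (subst (λ z → + z ≡ + i u [mod q ]) (sym (toℕ-fromℕ< _)) (reduce (i u) q))))
      where
      a b : ℕ
      a = toℕ (fromℕ< (m%n<n (i u) p))
      b = toℕ (fromℕ< (m%n<n (i u) q))

    to-from′ : ∀ x → to′ (from′ x) ≡ x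
    to-from′ (inj₁ a) with kind (from′ (inj₁ a))
    ... | over-p _     = cong inj₁ (fromℕ<-toℕ a _)
    ... | over-q p≡q   = ⊥-elim (<⇒≢ p<q p≡q)
    ... | over-pq p≡pq = ⊥-elim (<⇒≢ p<pq p≡pq)
    to-from′ (inj₂ (inj₁ b)) with kind (from′ (inj₂ (inj₁ b)))
    ... | over-p q≡p   = ⊥-elim (<⇒≢ p<q (sym q≡p))
    ... | over-q _     = cong (λ z → inj₂ (inj₁ z)) (fromℕ<-toℕ b _)
    ... | over-pq q≡pq = ⊥-elim (<⇒≢ q<pq q≡pq)
    to-from′ (inj₂ (inj₂ (a , b))) with kind (from′ (inj₂ (inj₂ (a , b))))
    ... | over-p pq≡p  = ⊥-elim (<⇒≢ p<pq (sym pq≡p))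
    ... | over-q pq≡q  = ⊥-elim (<⇒≢ q<pq (sym pq≡q))
    ... | over-pq _    = cong (λ z → inj₂ (inj₂ z)) (cong₂ _,_
          (toℕ-injective (trans (toℕ-fromℕ< _) (trans (mod⇒% (crt-p (toℕ a) (toℕ b))) (m<n⇒m%n≡m (toℕ<n a)))))
          (toℕ-injective (trans (toℕ-fromℕ< _) (trans (mod⇒% (crt-q (toℕ a) (toℕ b))) (m<n⇒m%n≡m (toℕ<n b))))))

    private
      in-u : ∀ {x a : Fin p} {b : Fin q} → InTriangle a b (inj₁ x) → x ≡ a
      in-u (inj₁ refl) = refl
      in-u (inj₂ (inj₁ ()))
      in-u (inj₂ (inj₂ ()))

      in-v : ∀ {y b : Fin q} {a : Fin p} → InTriangle a b (inj₂ (inj₁ y)) → y ≡ b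
      in-v (inj₁ ())
      in-v (inj₂ (inj₁ refl)) = refl
      in-v (inj₂ (inj₂ ()))

      in-w : ∀ {x a : Fin p} {y b : Fin q} → InTriangle a b (inj₂ (inj₂ (x , y))) → x ≡ a ∧ y ≡ b
      in-w (inj₁ ())
      in-w (inj₂ (inj₁ ()))
      in-w (inj₂ (inj₂ refl)) = refl , refl

      Compat : Param 3 (p * q) → Param 3 (p * q) → Set
      Compat u v = Compatible (p * q) (d u) (i u) (d v) (i v)

      agree : ∀ {r} → Prime r → 3 ≤ r → r ∣ p * q → ∀ {u v} → r ∣ d u → r ∣ d v → Compat u v → + i u ≡ + i v [mod r ]
      agree r-prime 3≤r r∣pq r∣du r∣dv c = halve r-prime 3≤r (compatible⇒mod r∣pq r∣du r∣dv c)

      over : ∀ {r x} → x ≡ r → r ∣ x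
      over refl = ∣-refl

      over-pq-p : ∀ {x} → x ≡ p * q → p ∣ x
      over-pq-p refl = p∣pq

      over-pq-q : ∀ {x} → x ≡ p * q → q ∣ x
      over-pq-q refl = q∣pq

      distinct : ∀ {u v : Param 3 (p * q)} → d u ≢ d v → u ≢ v
      distinct d≢ refl = d≢ refl

      at : ∀ {u v d₁ d₂} → d u ≡ d₁ → d v ≡ d₂ → Compatible (p * q) d₁ (i u) d₂ (i v) → Compat u v
      at refl refl c = c

    preserve : ∀ u v → Adj (ParamGraph 3 (p * q)) u v → Adj (TriGraph p q) (to′ u) (to′ v)
    preserve u v (u≢v , c) with kind u | kind v
    ... | over-p eu | over-p ev = ⊥-elim (u≢v (param-ext (trans eu (sym ev))
            (mod-residue (below u eu) (below v ev) (agree p-prime 3≤p p∣pq {u} {v} (over eu) (over ev) c))))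
    ... | over-q eu | over-q ev = ⊥-elim (u≢v (param-ext (trans eu (sym ev))
            (mod-residue (below u eu) (below v ev) (agree q-prime 3≤q q∣pq {u} {v} (over eu) (over ev) c))))
    ... | over-pq eu | over-pq ev = ⊥-elim (u≢v (param-ext (trans eu (sym ev))
            (crt-unique (below u eu) (below v ev) (agree p-prime 3≤p p∣pq {u} {v} (over-pq-p eu) (over-pq-p ev) c)
                                                  (agree q-prime 3≤q q∣pq {u} {v} (over-pq-q eu) (over-pq-q ev) c))))
    ... | over-p _ | over-q _ = (λ ()) , _ , _ , inj₁ refl , inj₂ (inj₁ refl)
    ... | over-q _ | over-p _ = (λ ()) , _ , _ , inj₂ (inj₁ refl) , inj₁ refl
    ... | over-p eu | over-pq ev = (λ ()) , _ , fromℕ< (m%n<n (i v) q) , inj₁ refl ,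
            inj₂ (inj₂ (cong (λ z → inj₂ (inj₂ (z , fromℕ< (m%n<n (i v) q)))) (fromℕ<-≡ (sym same-residue))))
      where same-residue : i u ≡ i v % p
            same-residue = mod-residue (below u eu) (m%n<n (i v) p)
                        (mod-trans (agree p-prime 3≤p p∣pq {u} {v} (over eu) (over-pq-p ev) c) (mod-sym (reduce (i v) p)))
    ... | over-pq eu | over-p ev = (λ ()) , _ , fromℕ< (m%n<n (i u) q) ,
            inj₂ (inj₂ (cong (λ z → inj₂ (inj₂ (z , fromℕ< (m%n<n (i u) q)))) (fromℕ<-≡ (sym same-residue)))) , inj₁ refl
      where same-residue : i v ≡ i u % p
            same-residue = mod-residue (below v ev) (m%n<n (i u) p)
                        (mod-trans (mod-sym (agree p-prime 3≤p p∣pq {u} {v} (over-pq-p eu) (over ev) c)) (mod-sym (reduce (i u) p)))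
    ... | over-q eu | over-pq ev = (λ ()) , fromℕ< (m%n<n (i v) p) , _ , inj₂ (inj₁ refl) ,
            inj₂ (inj₂ (cong (λ z → inj₂ (inj₂ (fromℕ< (m%n<n (i v) p) , z))) (fromℕ<-≡ (sym same-residue))))
      where same-residue : i u ≡ i v % q
            same-residue = mod-residue (below u eu) (m%n<n (i v) q)
                        (mod-trans (agree q-prime 3≤q q∣pq {u} {v} (over eu) (over-pq-q ev) c) (mod-sym (reduce (i v) q)))
    ... | over-pq eu | over-q ev = (λ ()) , fromℕ< (m%n<n (i u) p) , _ ,
            inj₂ (inj₂ (cong (λ z → inj₂ (inj₂ (fromℕ< (m%n<n (i u) p) , z))) (fromℕ<-≡ (sym same-residue)))) , inj₂ (inj₁ refl)
      where same-residue : i v ≡ i u % q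
            same-residue = mod-residue (below v ev) (m%n<n (i u) q)
                        (mod-trans (mod-sym (agree q-prime 3≤q q∣pq {u} {v} (over-pq-q eu) (over ev) c)) (mod-sym (reduce (i u) q)))

    reflect : ∀ u v → Adj (TriGraph p q) (to′ u) (to′ v) → Adj (ParamGraph 3 (p * q)) u v
    reflect u v (to-u≢to-v , a , b , tri-u , tri-v) with kind u | kind v
    ... | over-p _ | over-p _ = ⊥-elim (to-u≢to-v (cong inj₁ (trans (in-u tri-u) (sym (in-u tri-v)))))
    ... | over-q _ | over-q _ = ⊥-elim (to-u≢to-v (cong (λ z → inj₂ (inj₁ z)) (trans (in-v tri-u) (sym (in-v tri-v)))))
    ... | over-pq _ | over-pq _ = ⊥-elim (to-u≢to-v (cong (λ z → inj₂ (inj₂ z))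
            (cong₂ _,_ (trans (proj₁ (in-w tri-u)) (sym (proj₁ (in-w tri-v))))
                       (trans (proj₂ (in-w tri-u)) (sym (proj₂ (in-w tri-v)))))))
    ... | over-p eu | over-q ev = distinct (λ e → <⇒≢ p<q (trans (sym eu) (trans e ev))) ,
            at {u} {v} eu ev (coprime⇒compatible B (i u) (i v))
    ... | over-q eu | over-p ev = distinct (λ e → <⇒≢ p<q (trans (sym ev) (trans (sym e) eu))) ,
            at {u} {v} eu ev (compatible-sym (coprime⇒compatible B (i v) (i u)))
    ... | over-p eu | over-pq ev = distinct (λ e → <⇒≢ p<pq (trans (sym eu) (trans e ev))) ,
            at {u} {v} eu refl (mod⇒compatible (mod-trans (mod-reflexive (cong +_ same-residue)) (reduce (i v) p)))
      where same-residue : i u ≡ i v % p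
            same-residue = fromℕ<-injective (trans (in-u tri-u) (sym (proj₁ (in-w tri-v))))
    ... | over-pq eu | over-p ev = distinct (λ e → <⇒≢ p<pq (trans (sym ev) (trans (sym e) eu))) ,
            at {u} {v} refl ev (compatible-sym (mod⇒compatible (mod-trans (mod-reflexive (cong +_ same-residue)) (reduce (i u) p))))
      where same-residue : i v ≡ i u % p
            same-residue = fromℕ<-injective (trans (in-u tri-v) (sym (proj₁ (in-w tri-u))))
    ... | over-q eu | over-pq ev = distinct (λ e → <⇒≢ q<pq (trans (sym eu) (trans e ev))) ,
            at {u} {v} eu refl (mod⇒compatible (mod-trans (mod-reflexive (cong +_ same-residue)) (reduce (i v) q)))
      where same-residue : i u ≡ i v % q
            same-residue = fromℕ<-injective (trans (in-v tri-u) (sym (proj₂ (in-w tri-v))))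
    ... | over-pq eu | over-q ev = distinct (λ e → <⇒≢ q<pq (trans (sym ev) (trans (sym e) eu))) ,
            at {u} {v} refl ev (compatible-sym (mod⇒compatible (mod-trans (mod-reflexive (cong +_ same-residue)) (reduce (i u) q))))
      where same-residue : i v ≡ i u % q
            same-residue = fromℕ<-injective (trans (in-v tri-v) (sym (proj₂ (in-w tri-u))))

    iso : GraphIso (ParamGraph 3 (p * q)) (TriGraph p q)
    iso = record { to = to′ ; from = from′ ; from-to = from-to′ ; to-from = to-from′ ; adj⇒ = preserve ; adj⇐ = reflect }

open import Defs
open ParameterGraph
open GraphIso
open PrimePowers
open TwoPrimes
open import Data.Nat using (ℕ; suc; _*_; _^_; _∸_; _≤_; _<_; s≤s; z≤n)
open import Data.Nat.Properties using (m^n≢0; m*n≢0; *-identityʳ)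
open import Data.Nat.Primality using (Prime; prime⇒nonZero)
open import Data.Product using (_×_; _,_)
open import Relation.Binary.PropositionalEquality using (subst)

dihedral-4 : Γ_N (Dih 4) ≅ copies 2 (K 2)
dihedral-4 = GraphIso⇒≅ (Γ≅ParamGraph 4 ⟫ two-power-step 0 ⟫ copies-cong (empty-⊕ (no-params (s≤s (s≤s (s≤s z≤n))))))

dihedral-2^α : ∀ α → 3 ≤ α → Γ_N (Dih (2 ^ α) {{m^n≢0 2 α}}) ≅ copies 2 (Γ_N (Dih (2 ^ (α ∸ 1)) {{m^n≢0 2 (α ∸ 1)}}) ⊕ K 2)
dihedral-2^α (suc (suc (suc a))) (s≤s (s≤s (s≤s _))) = GraphIso⇒≅
  (Γ≅ParamGraph (2 ^ suc (suc (suc a))) {{m^n≢0 2 (suc (suc (suc a)))}}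
   ⟫ two-power-step (suc a)
   ⟫ copies-cong (⊕-cong (iso-sym (Γ≅ParamGraph (2 ^ suc (suc a)) {{m^n≢0 2 (suc (suc a))}})) iso-refl))

dihedral-p : ∀ p (p-prime : Prime p) → 2 < p → Γ_N (Dih p {{prime⇒nonZero p-prime}}) ≅ Kbar p
dihedral-p p p-prime 3≤p = GraphIso⇒≅
  (Γ≅ParamGraph p {{prime⇒nonZero p-prime}}
   ⟫ subst (λ n → GraphIso (ParamGraph 3 n) (copies p (ParamGraph 3 1 ⊕ K 1))) (*-identityʳ p) (odd-power-step p p-prime 3≤p 0)
   ⟫ copies-cong (empty-⊕ (no-params (s≤s (s≤s z≤n))))
   ⟫ copies-K1 p)

dihedral-p^α : ∀ p (p-prime : Prime p) → 2 < p → ∀ α → 2 ≤ α →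
        Γ_N (Dih (p ^ α) {{m^n≢0 p α {{prime⇒nonZero p-prime}}}})
          ≅ copies p (Γ_N (Dih (p ^ (α ∸ 1)) {{m^n≢0 p (α ∸ 1) {{prime⇒nonZero p-prime}}}}) ⊕ K 1)
dihedral-p^α p p-prime 3≤p (suc (suc a)) (s≤s (s≤s _)) = GraphIso⇒≅
  (Γ≅ParamGraph (p ^ suc (suc a)) {{m^n≢0 p (suc (suc a)) {{prime⇒nonZero p-prime}}}}
   ⟫ odd-power-step p p-prime 3≤p (suc a)
   ⟫ copies-cong (⊕-cong (iso-sym (Γ≅ParamGraph (p ^ suc a) {{m^n≢0 p (suc a) {{prime⇒nonZero p-prime}}}})) iso-refl))

dihedral-2p : ∀ p (p-prime : Prime p) → 2 < p → Γ_N (Dih (2 * p) {{m*n≢0 2 p {{_}} {{prime⇒nonZero p-prime}}}}) ≅ copies p (K 3)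
dihedral-2p p p-prime 3≤p = GraphIso⇒≅
  (Γ≅ParamGraph (2 * p) {{m*n≢0 2 p {{_}} {{prime⇒nonZero p-prime}}}} ⟫ twice-prime p p-prime 3≤p)

dihedral-pq : ∀ p q (p-prime : Prime p) (q-prime : Prime q) → 2 < p → p < q →
       Γ_N (Dih (p * q) {{m*n≢0 p q {{prime⇒nonZero p-prime}} {{prime⇒nonZero q-prime}}}}) ≅ TriGraph p q
dihedral-pq p q p-prime q-prime 3≤p p<q = GraphIso⇒≅
  (Γ≅ParamGraph (p * q) {{m*n≢0 p q {{prime⇒nonZero p-prime}} {{prime⇒nonZero q-prime}}}}
   ⟫ ProductOfTwoPrimes.iso p q p-prime q-prime 3≤p p<q)

theorem4p5 :
    -- (i)
    ((Γ_N (Dih 4) ≅ copies 2 (K 2))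
      × (∀ (α : ℕ) → 3 ≤ α →
           Γ_N (Dih (2 ^ α) {{m^n≢0 2 α}})
             ≅ copies 2 (Γ_N (Dih (2 ^ (α ∸ 1)) {{m^n≢0 2 (α ∸ 1)}}) ⊕ K 2)))
    -- (ii)
    × (∀ (p : ℕ) (pp : Prime p) → 2 < p →
         (Γ_N (Dih p {{prime⇒nonZero pp}}) ≅ Kbar p)
         × (∀ (α : ℕ) → 2 ≤ α →
              Γ_N (Dih (p ^ α) {{m^n≢0 p α {{prime⇒nonZero pp}}}})
                ≅ copies p (Γ_N (Dih (p ^ (α ∸ 1)) {{m^n≢0 p (α ∸ 1) {{prime⇒nonZero pp}}}}) ⊕ K 1)))
    -- (iii)
    × (∀ (p : ℕ) (pp : Prime p) → 2 < p →
         Γ_N (Dih (2 * p) {{m*n≢0 2 p {{_}} {{prime⇒nonZero pp}}}}) ≅ copies p (K 3))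
    -- (iv)
    × (∀ (p q : ℕ) (pp : Prime p) (pq : Prime q) → 2 < p → p < q →
         Γ_N (Dih (p * q) {{m*n≢0 p q {{prime⇒nonZero pp}} {{prime⇒nonZero pq}}}}) ≅ TriGraph p q)
theorem4p5 =
    (dihedral-4 , dihedral-2^α)
  , (λ p p-prime 3≤p → dihedral-p p p-prime 3≤p , dihedral-p^α p p-prime 3≤p)
  , dihedral-2p
  , dihedral-pq
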